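{- Let $M$ be a $\lambda\mu$-term. For every sum $\mathcal T\subseteq\mathcal T(M)$ there is a $\lambda\mu$-term $N$ with $M\twoheadrightarrow N$ and $\mathrm{nf}_r(\mathcal T)\subseteq\mathcal T(N)$.
   Context: Fix disjoint countably infinite sets of variables and names. $\lambda\mu$-terms: $M::=x\mid\lambda x.M\mid MM\mid\mu\alpha.{}_\beta|M|$, up to renaming of bound variables and names. Named application $(M)_\alpha N$: - $(x)_\alpha N=x$, $(\lambda x.M)_\alpha N=\lambda x.(M)_\alpha N$, $(MP)_\alpha N=((M)_\alpha N)((P)_\alpha N)$. - $(\mu\beta.{}_\gamma|M|)_\alpha N=\mu\beta.{}_\gamma|(M)_\alpha N|$ ($\gamma\ne\alpha$), and $(\mu\beta.{}_\alpha|M|)_\alpha N=\mu\beta.{}_\alpha|((M)_\alpha N)N|$. - On named terms analogously. Reduction on $\lambda\mu$-terms. $\to$ is the contextual closure of $(\lambda x.M)N\to M\{N/x\}$, $(\mu\alpha.{}_\beta|M|)N\to\mu\alpha.({}_\beta|M|)_\alpha N$, and $\mu\gamma.{}_\alpha|\mu\beta.{}_\eta|M||\to\mu\gamma.({}_\eta|M|)\{\alpha/\beta\}$. $\twoheadrightarrow$ is its reflexive–transitive closure. Resource terms and sums. - Resource terms: $t::=x\mid\lambda x.t\mid t[t_1,\dots,t_n]\mid\mu\alpha.{}_\beta|t|$, with bags finite multisets; $1$ is the empty bag. - Sums are finite sets with idempotent $+$ and empty sum $0$; constructors extend multilinearly, and $0$ annihilates. - A weak composition (w.c.) of a bag $B$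 is a tuple of possibly empty bags whose union is $B$. Linear substitution $t\langle B/x\rangle$: - $x\langle[v]/x\rangle=v$, and $x\langle B/x\rangle=0$ otherwise. - For $y\ne x$: $y\langle1/x\rangle=y$, and $y\langle B/x\rangle=0$ if $B\ne1$. - It commutes with $\lambda y$ and with $\mu\alpha.{}_\beta|\cdot|$. - $(t[v_1..v_n])\langle B/x\rangle=\sum_{(B_0..B_n)\text{ w.c.}}t\langle B_0/x\rangle[v_i\langle B_i/x\rangle]_i$. Linear named application $\langle t\rangle_\alpha B$: - $\langle x\rangle_\alpha1=x$, and $\langle x\rangle_\alpha B=0$ if $B\ne1$. - It commutes with $\lambda y$ and with $\mu\gamma$. - $\langle{}_\eta|t|\rangle_\alpha B={}_\eta|\langle t\rangle_\alpha B|$ ($\eta\ne\alpha$), and $\langle{}_\alpha|t|\rangle_\alpha B=\sum_{(B_1,B_2)\text{ w.c.}}{}_\alpha|(\langle t\rangle_\alpha B_1)B_2|$. - $\langle t[v_1..v_n]\rangle_\alpha B=\sum_{(B_0..B_n)}(\langle t\rangle_\alpha B_0)[\langle v_i\rangle_\alpha B_i]_i$. Resource reduction. $\to_r$ is the closure under single-hole resource contexts of $(\lambda x.t)B\to t\langle B/x\rangle$, $(\mu\alpha.{}_\beta|t|)B\to\mu\alpha.\langle{}_\beta|t|\rangle_\alpha B$, and $\mu\gamma.{}_\alpha|\mu\beta.{}_\eta|t||\to\mu\gamma.({}_\eta|t|)\{\alpha/\beta\}$, extended to sums by $t+\mathcal S\to_r\mathcal T+\mathcal S$ if $t\to_r\mathcal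 T$ and $t\notin\mathcal S$. It is confluent and strongly normalising; $\mathrm{nf}_r(\mathcal T)$ denotes the normal form of a sum $\mathcal T$. Taylor expansion. - $\mathcal T(x)=\{x\}$, $\mathcal T(\lambda x.M)=\{\lambda x.t\mid t\in\mathcal T(M)\}$, $\mathcal T(\mu\alpha.{}_\beta|M|)=\{\mu\alpha.{}_\beta|t|\mid t\in\mathcal T(M)\}$. - $\mathcal T(MN)=\{t[u_1..u_n]\mid t\in\mathcal T(M),n\ge0,u_i\in\mathcal T(N)\}$. -}

module Defs where

-- λμ-calculus, resource λμ-calculus and Taylor expansion, with de Bruijn
-- indices for BOTH variables and names (two separate index spaces, so that
-- terms are automatically taken up to renaming of bound variables and names).

open import Data.Nat using (ℕ; zero; suc; _+_; compare; less; equal; greater; _≟_)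
open import Data.List using (List; []; _∷_; _++_; map; concatMap; [_])
open import Data.List.Relation.Unary.All using (All)
open import Data.Product using (_×_; _,_; proj₁; proj₂)
open import Relation.Nullary using (¬_; yes; no)
open import Relation.Binary.Construct.Closure.ReflexiveTransitive using (Star)

ext : (ℕ → ℕ) → ℕ → ℕ
ext ρ zero    = zero
ext ρ (suc i) = suc (ρ i)

-- name substitution {α/β} used when removing the binder β (index 0):
-- β ↦ α, and every other name is lowered by one.
contr : ℕ → ℕ → ℕ
contr a zero    = a
contr a (suc i) = i

-- λμ-terms.  lam M binds variable 0 in M;  mu b M  is  μα.[b]M  where the
-- binder α is name 0 in scope of both b and M.

data Term : Set where
  var : ℕ → Term
  lam : Term → Term
  app : Term → Term → Term
  mu  : ℕ → Term → Term

renV : (ℕ → ℕ) → Term → Term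
renV ρ (var x)   = var (ρ x)
renV ρ (lam M)   = lam (renV (ext ρ) M)
renV ρ (app M N) = app (renV ρ M) (renV ρ N)
renV ρ (mu b M)  = mu b (renV ρ M)

renN : (ℕ → ℕ) → Term → Term
renN ρ (var x)   = var x
renN ρ (lam M)   = lam (renN ρ M)
renN ρ (app M N) = app (renN ρ M) (renN ρ N)
renN ρ (mu b M)  = mu (ext ρ b) (renN (ext ρ) M)

-- substT k N M = M{N/x} where x is variable k; variables above k are lowered
-- (N is given in the scope of the result).
substVar : ℕ → Term → ℕ → Term
substVar k N y with compare k y
... | less _ m    = var (k + m)
... | equal _     = N
... | greater _ _ = var y

substT : ℕ → Term → Term → Term
substT k N (var y)   = substVar k N y
substT k N (lam M)   = lam (substT (suc k) (renV suc N) M)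
substT k N (app M P) = app (substT k N M) (substT k N P)
substT k N (mu b M)  = mu b (substT k (renN suc N) M)

-- named application:  napp α N M = (M)_α N ;  nbody α N γ M = ([γ]M)_α N
-- (nbody returns the body of the resulting named term [γ]_ ).
mutual
  napp : ℕ → Term → Term → Term
  napp α N (var x)   = var x
  napp α N (lam M)   = lam (napp α (renV suc N) M)
  napp α N (app M P) = app (napp α N M) (napp α N P)
  napp α N (mu γ M)  = mu γ (nbody (suc α) (renN suc N) γ M)

  nbody : ℕ → Term → ℕ → Term → Term
  nbody α N γ M with γ ≟ α
  ... | yes _ = app (napp α N M) N
  ... | no _  = napp α N M

infix 4 _⟶_ _↠_

data _⟶_ : Term → Term → Set where
  β-red  : ∀ {M N} → app (lam M) N ⟶ substT 0 N M
  μ-red  : ∀ {b M N} → app (mu b M) N ⟶ mu b (nbody 0 (renN suc N) b M)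
  ρ-red  : ∀ {a e M} → mu a (mu e M) ⟶ mu (contr a e) (renN (contr a) M)
  ξ-lam  : ∀ {M M'} → M ⟶ M' → lam M ⟶ lam M'
  ξ-appL : ∀ {M M' N} → M ⟶ M' → app M N ⟶ app M' N
  ξ-appR : ∀ {M N N'} → N ⟶ N' → app M N ⟶ app M N'
  ξ-mu   : ∀ {b M M'} → M ⟶ M' → mu b M ⟶ mu b M'

_↠_ : Term → Term → Set
_↠_ = Star _⟶_

-- Resource terms.  Bags are lists read as finite multisets; sums are lists
-- read as finite sets (the sum denotes the set of its elements).

data RTerm : Set where
  rvar : ℕ → RTerm
  rlam : RTerm → RTerm
  rapp : RTerm → List RTerm → RTerm
  rmu  : ℕ → RTerm → RTerm

Bag : Set
Bag = List RTerm

Sum : Set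
Sum = List RTerm

mutual
  renVR : (ℕ → ℕ) → RTerm → RTerm
  renVR ρ (rvar x)    = rvar (ρ x)
  renVR ρ (rlam t)    = rlam (renVR (ext ρ) t)
  renVR ρ (rapp t vs) = rapp (renVR ρ t) (renVB ρ vs)
  renVR ρ (rmu b t)   = rmu b (renVR ρ t)

  renVB : (ℕ → ℕ) → Bag → Bag
  renVB ρ []       = []
  renVB ρ (v ∷ vs) = renVR ρ v ∷ renVB ρ vs

mutual
  renNR : (ℕ → ℕ) → RTerm → RTerm
  renNR ρ (rvar x)    = rvar x
  renNR ρ (rlam t)    = rlam (renNR ρ t)
  renNR ρ (rapp t vs) = rapp (renNR ρ t) (renNB ρ vs)
  renNR ρ (rmu b t)   = rmu (ext ρ b) (renNR (ext ρ) t)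

  renNB : (ℕ → ℕ) → Bag → Bag
  renNB ρ []       = []
  renNB ρ (v ∷ vs) = renNR ρ v ∷ renNB ρ vs

splits2 : Bag → List (Bag × Bag)
splits2 []      = ([] , []) ∷ []
splits2 (v ∷ B) = concatMap (λ p → (v ∷ proj₁ p , proj₂ p) ∷ (proj₁ p , v ∷ proj₂ p) ∷ []) (splits2 B)

onlyEmpty : {A : Set} → Bag → A → List A
onlyEmpty []      x = x ∷ []
onlyEmpty (_ ∷ _) x = []

single : Bag → Sum
single (v ∷ []) = v ∷ []
single _        = []

-- linear substitution: lsub k B t = t⟨B/x⟩ with x the variable k (variables
-- above k are lowered; B is in the scope of the result).
-- lsubB k B vs = sum over weak compositions of B of the bags [vᵢ⟨Bᵢ/x⟩]ᵢ.
lsubVar : ℕ → Bag → ℕ → Sum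
lsubVar k B y with compare k y
... | less _ m    = onlyEmpty B (rvar (k + m))
... | equal _     = single B
... | greater _ _ = onlyEmpty B (rvar y)

mutual
  lsub : ℕ → Bag → RTerm → Sum
  lsub k B (rvar y)    = lsubVar k B y
  lsub k B (rlam t)    = map rlam (lsub (suc k) (renVB suc B) t)
  lsub k B (rmu b t)   = map (rmu b) (lsub k (renNB suc B) t)
  lsub k B (rapp t vs) =
    concatMap (λ p → concatMap (λ u → map (rapp u) (lsubB k (proj₂ p) vs))
                               (lsub k (proj₁ p) t))
              (splits2 B)

  lsubB : ℕ → Bag → Bag → List Bag
  lsubB k B []       = onlyEmpty B []
  lsubB k B (v ∷ vs) =
    concatMap (λ p → concatMap (λ u → map (u ∷_) (lsubB k (proj₂ p) vs))
                               (lsub k (proj₁ p) v))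
              (splits2 B)

-- linear named application: napR α B t = ⟨t⟩_α B ;
-- nbodyR α B γ t = ⟨[γ]t⟩_α B  (as the sum of bodies of named terms [γ]_ ).
mutual
  napR : ℕ → Bag → RTerm → Sum
  napR α B (rvar x)    = onlyEmpty B (rvar x)
  napR α B (rlam t)    = map rlam (napR α (renVB suc B) t)
  napR α B (rmu γ t)   = map (rmu γ) (nbodyR (suc α) (renNB suc B) γ t)
  napR α B (rapp t vs) =
    concatMap (λ p → concatMap (λ u → map (rapp u) (napB α (proj₂ p) vs))
                               (napR α (proj₁ p) t))
              (splits2 B)

  napB : ℕ → Bag → Bag → List Bag
  napB α B []       = onlyEmpty B []
  napB α B (v ∷ vs) =
    concatMap (λ p → concatMap (λ u → map (u ∷_) (napB α (proj₂ p) vs))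
                               (napR α (proj₁ p) v))
              (splits2 B)

  nbodyR : ℕ → Bag → ℕ → RTerm → Sum
  nbodyR α B γ t with γ ≟ α
  ... | yes _ = concatMap (λ p → map (λ u → rapp u (proj₂ p)) (napR α (proj₁ p) t)) (splits2 B)
  ... | no _  = napR α B t

infix 4 _⟶r_ _⟶s_

data _⟶r_ : RTerm → Sum → Set where
  β-r   : ∀ {t B} → rapp (rlam t) B ⟶r lsub 0 B t
  μ-r   : ∀ {b t B} → rapp (rmu b t) B ⟶r map (rmu b) (nbodyR 0 (renNB suc B) b t)
  ρ-r   : ∀ {a e t} → rmu a (rmu e t) ⟶r [ rmu (contr a e) (renNR (contr a) t) ]
  ξ-rlam  : ∀ {t T} → t ⟶r T → rlam t ⟶r map rlam T
  ξ-rmu   : ∀ {b t T} → t ⟶r T → rmu b t ⟶r map (rmu b) T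
  ξ-rappL : ∀ {t T B} → t ⟶r T → rapp t B ⟶r map (λ u → rapp u B) T
  ξ-rappR : ∀ {s t T} (L R : Bag) → t ⟶r T →
            rapp s (L ++ t ∷ R) ⟶r map (λ u → rapp s (L ++ u ∷ R)) T

data _⟶s_ : Sum → Sum → Set where
  step : ∀ {t T} (L R : Sum) → t ⟶r T → (L ++ t ∷ R) ⟶s (L ++ T ++ R)

NormalS : Sum → Set
NormalS S = ∀ S' → ¬ (S ⟶s S')

IsNF : Sum → Sum → Set
IsNF T S = Star _⟶s_ T S × NormalS S

-- Taylor expansion, as a membership predicate  t ∈𝒯 M  ⇔  t ∈ 𝒯(M)

infix 4 _∈𝒯_

data _∈𝒯_ : RTerm → Term → Set where
  𝒯-var : ∀ {x} → rvar x ∈𝒯 var x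
  𝒯-lam : ∀ {t M} → t ∈𝒯 M → rlam t ∈𝒯 lam M
  𝒯-mu  : ∀ {b t M} → t ∈𝒯 M → rmu b t ∈𝒯 mu b M
  𝒯-app : ∀ {t us M N} → t ∈𝒯 M → All (_∈𝒯 N) us → rapp t us ∈𝒯 app M N

_⊆𝒯_ : Sum → Term → Set
S ⊆𝒯 M = All (_∈𝒯 M) S

module Submission where

-- Resource reduction is simulated by λμ-reduction: every summand of a
-- resource reduct of T ⊆ 𝒯(M) lies in the Taylor expansion of M up to reducing M,
-- where different copies of an argument may be reduced independently (the
-- relation ◁). Such independent reducts are reconciled by complete developments:
-- by the Z property, devⁿ k M is a common reduct of all k-step reducts of M, and
-- since the Taylor support of a normal resource term is stable under reduction,
-- every normal s ◁ M lies in 𝒯(devⁿ k M) for some k. Resource reduction is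
-- strongly normalising and finitely branching, so a single k bounds all normal
-- descendants of the finitely many summands of T.

open import Defs
open import Data.Empty using (⊥; ⊥-elim)
open import Data.List using (List; []; _∷_; _++_; map; concatMap; [_])
open import Data.List.Membership.Propositional using (_∈_)
open import Data.List.Membership.Propositional.Properties using (∈-++⁺ˡ; ∈-++⁺ʳ; ∈-++⁻; ∈-∃++)
open import Data.List.Properties using (++-assoc; map-cong)
open import Data.List.Relation.Unary.All as All using (All; []; _∷_; lookup)
open import Data.List.Relation.Unary.All.Properties using (++⁺; ++⁻; gmap⁺; concat⁺)
open import Data.List.Relation.Unary.Any as Any using (Any; here; there)
open import Data.List.Relation.Unary.Any.Properties as Any using (++⁺ˡ; ++⁺ʳ; ¬Any[])
open import Data.Nat using (ℕ; zero; suc; _+_; _*_; _∸_; _^_; _⊔_; _≟_; compare; less; equal; greater)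
open import Data.Nat using (_≤_; _<_; z≤n; s≤s; _≤′_; ≤′-reflexive; ≤′-step; >-nonZero)
open import Data.Nat.Induction using (<-wellFounded)
open import Data.Nat.Properties
open import Data.Nat.Tactic.RingSolver using (solve-∀)
open import Algebra.Properties.CommutativeSemigroup +-commutativeSemigroup using (interchange; x∙yz≈y∙xz)
open import Data.Product using (_×_; _,_; proj₁; proj₂; Σ; ∃-syntax; curry)
open import Data.Product.Relation.Binary.Lex.Strict using (×-Lex; ×-wellFounded)
open import Data.Sum using (_⊎_; inj₁; inj₂)
open import Data.Unit using (⊤; tt)
open import Function using (_∘_; _on_)
open import Induction.WellFounded using (WellFounded; module All)
import Relation.Binary.Construct.On as On
open import Relation.Binary.Construct.Closure.ReflexiveTransitive using (Star; ε; _◅_; _◅◅_; return; gmap; kleisliStar)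
open import Relation.Binary.PropositionalEquality hiding ([_])
open import Relation.Nullary using (¬_; Dec; yes; no)

-- Renaming and substitution

ext-cong : ∀ {ρ ρ'} → (∀ x → ρ x ≡ ρ' x) → ∀ x → ext ρ x ≡ ext ρ' x
ext-cong h zero = refl
ext-cong h (suc x) = cong suc (h x)

renV-cong : ∀ {ρ ρ'} → (∀ x → ρ x ≡ ρ' x) → ∀ M → renV ρ M ≡ renV ρ' M
renV-cong h (var x) = cong var (h x)
renV-cong h (lam M) = cong lam (renV-cong (ext-cong h) M)
renV-cong h (app M N) = cong₂ app (renV-cong h M) (renV-cong h N)
renV-cong h (mu b M) = cong (mu b) (renV-cong h M)

renN-cong : ∀ {ρ ρ'} → (∀ x → ρ x ≡ ρ' x) → ∀ M → renN ρ M ≡ renN ρ' M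
renN-cong h (var x) = refl
renN-cong h (lam M) = cong lam (renN-cong h M)
renN-cong h (app M N) = cong₂ app (renN-cong h M) (renN-cong h N)
renN-cong h (mu b M) = cong₂ mu (ext-cong h b) (renN-cong (ext-cong h) M)

ext-∘ : ∀ ρ ρ' x → ext ρ (ext ρ' x) ≡ ext (ρ ∘ ρ') x
ext-∘ ρ ρ' zero = refl
ext-∘ ρ ρ' (suc x) = refl

renV-renV : ∀ ρ ρ' M → renV ρ (renV ρ' M) ≡ renV (ρ ∘ ρ') M
renV-renV ρ ρ' (var x) = refl
renV-renV ρ ρ' (lam M) = cong lam (trans (renV-renV (ext ρ) (ext ρ') M) (renV-cong (ext-∘ ρ ρ') M))
renV-renV ρ ρ' (app M N) = cong₂ app (renV-renV ρ ρ' M) (renV-renV ρ ρ' N)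
renV-renV ρ ρ' (mu b M) = cong (mu b) (renV-renV ρ ρ' M)

renN-renN : ∀ ρ ρ' M → renN ρ (renN ρ' M) ≡ renN (ρ ∘ ρ') M
renN-renN ρ ρ' (var x) = refl
renN-renN ρ ρ' (lam M) = cong lam (renN-renN ρ ρ' M)
renN-renN ρ ρ' (app M N) = cong₂ app (renN-renN ρ ρ' M) (renN-renN ρ ρ' N)
renN-renN ρ ρ' (mu b M) = cong₂ mu (ext-∘ ρ ρ' b) (trans (renN-renN (ext ρ) (ext ρ') M) (renN-cong (ext-∘ ρ ρ') M))

renV-renN : ∀ ρ ρ' M → renV ρ (renN ρ' M) ≡ renN ρ' (renV ρ M)
renV-renN ρ ρ' (var x) = refl
renV-renN ρ ρ' (lam M) = cong lam (renV-renN (ext ρ) ρ' M)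
renV-renN ρ ρ' (app M N) = cong₂ app (renV-renN ρ ρ' M) (renV-renN ρ ρ' N)
renV-renN ρ ρ' (mu b M) = cong (mu (ext ρ' b)) (renV-renN ρ (ext ρ') M)

ext-id : ∀ {ρ} → (∀ x → ρ x ≡ x) → ∀ x → ext ρ x ≡ x
ext-id h zero = refl
ext-id h (suc x) = cong suc (h x)

renV-id : ∀ {ρ} → (∀ x → ρ x ≡ x) → ∀ M → renV ρ M ≡ M
renV-id h (var x) = cong var (h x)
renV-id h (lam M) = cong lam (renV-id (ext-id h) M)
renV-id h (app M N) = cong₂ app (renV-id h M) (renV-id h N)
renV-id h (mu b M) = cong (mu b) (renV-id h M)

renN-id : ∀ {ρ} → (∀ x → ρ x ≡ x) → ∀ M → renN ρ M ≡ M
renN-id h (var x) = refl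
renN-id h (lam M) = cong lam (renN-id h M)
renN-id h (app M N) = cong₂ app (renN-id h M) (renN-id h N)
renN-id h (mu b M) = cong₂ mu (ext-id h b) (renN-id (ext-id h) M)

exts : (ℕ → Term) → ℕ → Term
exts σ zero = var zero
exts σ (suc x) = renV suc (σ x)

sub : (ℕ → Term) → Term → Term
sub σ (var x) = σ x
sub σ (lam M) = lam (sub (exts σ) M)
sub σ (app M N) = app (sub σ M) (sub σ N)
sub σ (mu b M) = mu b (sub (renN suc ∘ σ) M)

exts-cong : ∀ {σ σ'} → (∀ x → σ x ≡ σ' x) → ∀ x → exts σ x ≡ exts σ' x
exts-cong h zero = refl
exts-cong h (suc x) = cong (renV suc) (h x)

sub-cong : ∀ {σ σ'} → (∀ x → σ x ≡ σ' x) → ∀ M → sub σ M ≡ sub σ' M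
sub-cong h (var x) = h x
sub-cong h (lam M) = cong lam (sub-cong (exts-cong h) M)
sub-cong h (app M N) = cong₂ app (sub-cong h M) (sub-cong h N)
sub-cong h (mu b M) = cong (mu b) (sub-cong (λ x → cong (renN suc) (h x)) M)

renV-sub : ∀ ρ σ M → renV ρ (sub σ M) ≡ sub (renV ρ ∘ σ) M
renV-sub ρ σ (var x) = refl
renV-sub ρ σ (lam M) = cong lam (trans (renV-sub (ext ρ) (exts σ) M) (sub-cong h M))
  where
  h : ∀ x → renV (ext ρ) (exts σ x) ≡ exts (renV ρ ∘ σ) x
  h zero = refl
  h (suc x) = trans (renV-renV (ext ρ) suc (σ x)) (sym (renV-renV suc ρ (σ x)))
renV-sub ρ σ (app M N) = cong₂ app (renV-sub ρ σ M) (renV-sub ρ σ N)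
renV-sub ρ σ (mu b M) = cong (mu b) (trans (renV-sub ρ (renN suc ∘ σ) M) (sub-cong (λ x → renV-renN ρ suc (σ x)) M))

sub-renV : ∀ σ ρ M → sub σ (renV ρ M) ≡ sub (σ ∘ ρ) M
sub-renV σ ρ (var x) = refl
sub-renV σ ρ (lam M) = cong lam (trans (sub-renV (exts σ) (ext ρ) M) (sub-cong h M))
  where
  h : ∀ x → exts σ (ext ρ x) ≡ exts (σ ∘ ρ) x
  h zero = refl
  h (suc x) = refl
sub-renV σ ρ (app M N) = cong₂ app (sub-renV σ ρ M) (sub-renV σ ρ N)
sub-renV σ ρ (mu b M) = cong (mu b) (sub-renV (renN suc ∘ σ) ρ M)

renN-sub : ∀ ρ σ M → renN ρ (sub σ M) ≡ sub (renN ρ ∘ σ) (renN ρ M)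
renN-sub ρ σ (var x) = refl
renN-sub ρ σ (lam M) = cong lam (trans (renN-sub ρ (exts σ) M) (sub-cong h (renN ρ M)))
  where
  h : ∀ x → renN ρ (exts σ x) ≡ exts (renN ρ ∘ σ) x
  h zero = refl
  h (suc x) = sym (renV-renN suc ρ (σ x))
renN-sub ρ σ (app M N) = cong₂ app (renN-sub ρ σ M) (renN-sub ρ σ N)
renN-sub ρ σ (mu b M) = cong (mu (ext ρ b)) (trans (renN-sub (ext ρ) (renN suc ∘ σ) M) (sub-cong h (renN (ext ρ) M)))
  where
  h : ∀ x → renN (ext ρ) (renN suc (σ x)) ≡ renN suc (renN ρ (σ x))
  h x = trans (renN-renN (ext ρ) suc (σ x)) (sym (renN-renN suc ρ (σ x)))

sub-sub : ∀ σ τ M → sub σ (sub τ M) ≡ sub (sub σ ∘ τ) M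
sub-sub σ τ (var x) = refl
sub-sub σ τ (lam M) = cong lam (trans (sub-sub (exts σ) (exts τ) M) (sub-cong h M))
  where
  h : ∀ x → sub (exts σ) (exts τ x) ≡ exts (sub σ ∘ τ) x
  h zero = refl
  h (suc x) = trans (sub-renV (exts σ) suc (τ x)) (sym (renV-sub suc σ (τ x)))
sub-sub σ τ (app M N) = cong₂ app (sub-sub σ τ M) (sub-sub σ τ N)
sub-sub σ τ (mu b M) = cong (mu b) (trans (sub-sub (renN suc ∘ σ) (renN suc ∘ τ) M) (sub-cong h M))
  where
  h : ∀ x → sub (renN suc ∘ σ) (renN suc (τ x)) ≡ renN suc (sub σ (τ x))
  h x = sym (renN-sub suc σ (τ x))

sub-id : ∀ {σ} → (∀ x → σ x ≡ var x) → ∀ M → sub σ M ≡ M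
sub-id h (var x) = h x
sub-id {σ} h (lam M) = cong lam (sub-id h' M)
  where
  h' : ∀ x → exts σ x ≡ var x
  h' zero = refl
  h' (suc x) = cong (renV suc) (h x)
sub-id h (app M N) = cong₂ app (sub-id h M) (sub-id h N)
sub-id h (mu b M) = cong (mu b) (sub-id (λ x → cong (renN suc) (h x)) M)

renV-suc-substVar : ∀ k N y → renV suc (substVar k N y) ≡ substVar (suc k) (renV suc N) (suc y)
renV-suc-substVar k N y with compare k y
... | less _ m = refl
... | equal _ = refl
... | greater _ _ = refl

renN-substVar : ∀ ρ k N y → renN ρ (substVar k N y) ≡ substVar k (renN ρ N) y
renN-substVar ρ k N y with compare k y
... | less _ m = refl
... | equal _ = refl
... | greater _ _ = refl

substT≡sub : ∀ k N M → substT k N M ≡ sub (substVar k N) M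
substT≡sub k N (var x) = refl
substT≡sub k N (lam M) = cong lam (trans (substT≡sub (suc k) (renV suc N) M) (sym (sub-cong h M)))
  where
  h : ∀ x → exts (substVar k N) x ≡ substVar (suc k) (renV suc N) x
  h zero = refl
  h (suc y) = renV-suc-substVar k N y
substT≡sub k N (app M P) = cong₂ app (substT≡sub k N M) (substT≡sub k N P)
substT≡sub k N (mu b M) = cong (mu b) (trans (substT≡sub k (renN suc N) M) (sym (sub-cong (λ y → renN-substVar suc k N y) M)))

-- Named application

mutual
  renV-napp : ∀ ρ α N M → renV ρ (napp α N M) ≡ napp α (renV ρ N) (renV ρ M)
  renV-napp ρ α N (var x) = refl
  renV-napp ρ α N (lam M) = cong lam (trans (renV-napp (ext ρ) α (renV suc N) M)
      (cong (λ z → napp α z (renV (ext ρ) M)) (trans (renV-renV (ext ρ) suc N) (sym (renV-renV suc ρ N)))))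
  renV-napp ρ α N (app M P) = cong₂ app (renV-napp ρ α N M) (renV-napp ρ α N P)
  renV-napp ρ α N (mu γ M) = cong (mu γ) (trans (renV-nbody ρ (suc α) (renN suc N) γ M)
      (cong (λ z → nbody (suc α) z γ (renV ρ M)) (renV-renN ρ suc N)))

  renV-nbody : ∀ ρ α N γ M → renV ρ (nbody α N γ M) ≡ nbody α (renV ρ N) γ (renV ρ M)
  renV-nbody ρ α N γ M with γ ≟ α
  ... | yes _ = cong₂ app (renV-napp ρ α N M) refl
  ... | no _ = renV-napp ρ α N M

InjectiveAt : (ℕ → ℕ) → ℕ → Set
InjectiveAt ρ α = ∀ i → ρ i ≡ ρ α → i ≡ α

InjectiveAt-ext : ∀ {ρ α} → InjectiveAt ρ α → InjectiveAt (ext ρ) (suc α)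
InjectiveAt-ext h zero ()
InjectiveAt-ext h (suc i) e = cong suc (h i (suc-injective e))

suc-injectiveAt : ∀ α → InjectiveAt suc α
suc-injectiveAt α i e = suc-injective e

renN-ext-suc : ∀ ρ N → renN (ext ρ) (renN suc N) ≡ renN suc (renN ρ N)
renN-ext-suc ρ N = trans (renN-renN (ext ρ) suc N) (sym (renN-renN suc ρ N))

mutual
  renN-napp : ∀ ρ α N M → InjectiveAt ρ α → renN ρ (napp α N M) ≡ napp (ρ α) (renN ρ N) (renN ρ M)
  renN-napp ρ α N (var x) h = refl
  renN-napp ρ α N (lam M) h = cong lam (trans (renN-napp ρ α (renV suc N) M h)
      (cong (λ z → napp (ρ α) z (renN ρ M)) (sym (renV-renN suc ρ N))))
  renN-napp ρ α N (app M P) h = cong₂ app (renN-napp ρ α N M h) (renN-napp ρ α N P h)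
  renN-napp ρ α N (mu γ M) h = cong (mu (ext ρ γ)) (trans (renN-nbody (ext ρ) (suc α) (renN suc N) γ M (InjectiveAt-ext h))
      (cong (λ z → nbody (suc (ρ α)) z (ext ρ γ) (renN (ext ρ) M)) (renN-ext-suc ρ N)))

  renN-nbody : ∀ ρ α N γ M → InjectiveAt ρ α → renN ρ (nbody α N γ M) ≡ nbody (ρ α) (renN ρ N) (ρ γ) (renN ρ M)
  renN-nbody ρ α N γ M h with γ ≟ α | ρ γ ≟ ρ α
  ... | yes _ | yes _ = cong₂ app (renN-napp ρ α N M h) refl
  ... | yes p | no q = ⊥-elim (q (cong ρ p))
  ... | no p | yes q = ⊥-elim (p (h γ q))
  ... | no _ | no _ = renN-napp ρ α N M h

Fresh : ℕ → Term → Set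
Fresh β (var x) = ⊤
Fresh β (lam M) = Fresh β M
Fresh β (app M N) = Fresh β M × Fresh β N
Fresh β (mu b M) = b ≢ suc β × Fresh (suc β) M

mutual
  napp-fresh : ∀ β Q M → Fresh β M → napp β Q M ≡ M
  napp-fresh β Q (var x) h = refl
  napp-fresh β Q (lam M) h = cong lam (napp-fresh β (renV suc Q) M h)
  napp-fresh β Q (app M N) (h1 , h2) = cong₂ app (napp-fresh β Q M h1) (napp-fresh β Q N h2)
  napp-fresh β Q (mu b M) (h1 , h2) = cong (mu b) (nbody-fresh (suc β) (renN suc Q) b M h1 h2)

  nbody-fresh : ∀ β Q b M → b ≢ β → Fresh β M → nbody β Q b M ≡ M
  nbody-fresh β Q b M nb h with b ≟ β
  ... | yes p = ⊥-elim (nb p)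
  ... | no _ = napp-fresh β Q M h

renN-fresh-outside : ∀ ρ β' M → (∀ i → ρ i ≢ β') → Fresh β' (renN ρ M)
renN-fresh-outside ρ β' (var x) h = tt
renN-fresh-outside ρ β' (lam M) h = renN-fresh-outside ρ β' M h
renN-fresh-outside ρ β' (app M N) h = renN-fresh-outside ρ β' M h , renN-fresh-outside ρ β' N h
renN-fresh-outside ρ β' (mu b M) h = ext-avoids b , renN-fresh-outside (ext ρ) (suc β') M ext-avoids
  where
  ext-avoids : ∀ i → ext ρ i ≢ suc β'
  ext-avoids zero ()
  ext-avoids (suc i) e = h i (suc-injective e)

renN-fresh : ∀ ρ β β' M → (∀ i → ρ i ≡ β' → i ≡ β) → Fresh β M → Fresh β' (renN ρ M)
renN-fresh ρ β β' (var x) h n = tt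
renN-fresh ρ β β' (lam M) h n = renN-fresh ρ β β' M h n
renN-fresh ρ β β' (app M N) h (n1 , n2) = renN-fresh ρ β β' M h n1 , renN-fresh ρ β β' N h n2
renN-fresh ρ β β' (mu b M) h (n1 , n2) = (λ e → n1 (ext-preimage b e)) , renN-fresh (ext ρ) (suc β) (suc β') M ext-preimage n2
  where
  ext-preimage : ∀ i → ext ρ i ≡ suc β' → i ≡ suc β
  ext-preimage zero ()
  ext-preimage (suc i) e = cong suc (h i (suc-injective e))

renN-suc-fresh : ∀ M → Fresh zero (renN suc M)
renN-suc-fresh M = renN-fresh-outside suc zero M (λ i ())

renV-fresh : ∀ ρ β M → Fresh β M → Fresh β (renV ρ M)
renV-fresh ρ β (var x) h = tt
renV-fresh ρ β (lam M) h = renV-fresh (ext ρ) β M h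
renV-fresh ρ β (app M N) (h1 , h2) = renV-fresh ρ β M h1 , renV-fresh ρ β N h2
renV-fresh ρ β (mu b M) (h1 , h2) = h1 , renV-fresh ρ (suc β) M h2

renN-suc-fresh-suc : ∀ β M → Fresh β M → Fresh (suc β) (renN suc M)
renN-suc-fresh-suc β M = renN-fresh suc β (suc β) M (λ i e → suc-injective e)

mutual
  napp-sub : ∀ α N N' σ σ' M → (∀ x → σ' x ≡ napp α N' (σ x)) → sub σ' N ≡ N' →
             napp α N' (sub σ M) ≡ sub σ' (napp α N M)
  napp-sub α N N' σ σ' (var x) h1 h2 = sym (h1 x)
  napp-sub α N N' σ σ' (lam M) h1 h2 =
    cong lam (napp-sub α (renV suc N) (renV suc N') (exts σ) (exts σ') M h1' h2')
    where
    h1' : ∀ x → exts σ' x ≡ napp α (renV suc N') (exts σ x)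
    h1' zero = refl
    h1' (suc y) = trans (cong (renV suc) (h1 y)) (renV-napp suc α N' (σ y))
    h2' : sub (exts σ') (renV suc N) ≡ renV suc N'
    h2' = trans (sub-renV (exts σ') suc N) (trans (sym (renV-sub suc σ' N)) (cong (renV suc) h2))
  napp-sub α N N' σ σ' (app M P) h1 h2 = cong₂ app (napp-sub α N N' σ σ' M h1 h2) (napp-sub α N N' σ σ' P h1 h2)
  napp-sub α N N' σ σ' (mu b M) h1 h2 =
    cong (mu b) (nbody-sub (suc α) (renN suc N) (renN suc N') (renN suc ∘ σ) (renN suc ∘ σ') b M h1' h2')
    where
    h1' : ∀ x → renN suc (σ' x) ≡ napp (suc α) (renN suc N') (renN suc (σ x))
    h1' x = trans (cong (renN suc) (h1 x)) (renN-napp suc α N' (σ x) (suc-injectiveAt α))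
    h2' : sub (renN suc ∘ σ') (renN suc N) ≡ renN suc N'
    h2' = trans (sym (renN-sub suc σ' N)) (cong (renN suc) h2)

  nbody-sub : ∀ α N N' σ σ' γ M → (∀ x → σ' x ≡ napp α N' (σ x)) → sub σ' N ≡ N' →
              nbody α N' γ (sub σ M) ≡ sub σ' (nbody α N γ M)
  nbody-sub α N N' σ σ' γ M h1 h2 with γ ≟ α
  ... | yes _ = cong₂ app (napp-sub α N N' σ σ' M h1 h2) (sym h2)
  ... | no _ = napp-sub α N N' σ σ' M h1 h2

mutual
  napp-napp : ∀ α β N Q M → α ≢ β → Fresh β N →
              napp α N (napp β Q M) ≡ napp β (napp α N Q) (napp α N M)
  napp-napp α β N Q (var x) ne nf = refl
  napp-napp α β N Q (lam M) ne nf = cong lam (trans (napp-napp α β (renV suc N) (renV suc Q) M ne (renV-fresh suc β N nf))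
      (cong (λ z → napp β z (napp α (renV suc N) M)) (sym (renV-napp suc α N Q))))
  napp-napp α β N Q (app M P) ne nf = cong₂ app (napp-napp α β N Q M ne nf) (napp-napp α β N Q P ne nf)
  napp-napp α β N Q (mu γ M) ne nf = cong (mu γ) (trans
      (nbody-nbody (suc α) (suc β) (renN suc N) (renN suc Q) γ M (λ e → ne (suc-injective e)) (renN-suc-fresh-suc β N nf))
      (cong (λ z → nbody (suc β) z γ (nbody (suc α) (renN suc N) γ M)) (sym (renN-napp suc α N Q (suc-injectiveAt α)))))

  nbody-nbody : ∀ α β N Q γ M → α ≢ β → Fresh β N →
                nbody α N γ (nbody β Q γ M) ≡ nbody β (napp α N Q) γ (nbody α N γ M)
  nbody-nbody α β N Q γ M ne nf with γ ≟ β | γ ≟ α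
  ... | yes p | yes q = ⊥-elim (ne (trans (sym q) p))
  ... | yes p | no q = cong₂ app (napp-napp α β N Q M ne nf) refl
  ... | no p | yes q = cong₂ app (napp-napp α β N Q M ne nf) (sym (napp-fresh β (napp α N Q) N nf))
  ... | no p | no q = napp-napp α β N Q M ne nf

Merges : (ℕ → ℕ) → ℕ → ℕ → ℕ → Set
Merges ρ α β δ = (ρ α ≡ δ) × (ρ β ≡ δ) × (∀ i → ρ i ≡ δ → (i ≡ α) ⊎ (i ≡ β)) × α ≢ β

Merges-ext : ∀ {ρ α β δ} → Merges ρ α β δ → Merges (ext ρ) (suc α) (suc β) (suc δ)
Merges-ext {ρ} {α} {β} {δ} (e1 , e2 , h , ne) = cong suc e1 , cong suc e2 , ext-merged , (λ e → ne (suc-injective e))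
  where
  ext-merged : ∀ i → ext ρ i ≡ suc δ → (i ≡ suc α) ⊎ (i ≡ suc β)
  ext-merged zero ()
  ext-merged (suc i) e with h i (suc-injective e)
  ... | inj₁ p = inj₁ (cong suc p)
  ... | inj₂ p = inj₂ (cong suc p)

mutual
  renN-napp-merge : ∀ ρ α β δ Na Nb Ns M → Merges ρ α β δ → Fresh β Na → renN ρ Na ≡ Ns → renN ρ Nb ≡ Ns →
               renN ρ (napp β Nb (napp α Na M)) ≡ napp δ Ns (renN ρ M)
  renN-napp-merge ρ α β δ Na Nb Ns (var x) mc nf ea eb = refl
  renN-napp-merge ρ α β δ Na Nb Ns (lam M) mc nf ea eb = cong lam
    (renN-napp-merge ρ α β δ (renV suc Na) (renV suc Nb) (renV suc Ns) M mc (renV-fresh suc β Na nf)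
       (trans (sym (renV-renN suc ρ Na)) (cong (renV suc) ea)) (trans (sym (renV-renN suc ρ Nb)) (cong (renV suc) eb)))
  renN-napp-merge ρ α β δ Na Nb Ns (app M P) mc nf ea eb =
    cong₂ app (renN-napp-merge ρ α β δ Na Nb Ns M mc nf ea eb) (renN-napp-merge ρ α β δ Na Nb Ns P mc nf ea eb)
  renN-napp-merge ρ α β δ Na Nb Ns (mu γ M) mc nf ea eb = cong (mu (ext ρ γ))
    (renN-nbody-merge (ext ρ) (suc α) (suc β) (suc δ) (renN suc Na) (renN suc Nb) (renN suc Ns) γ M (Merges-ext mc)
      (renN-suc-fresh-suc β Na nf) (trans (renN-ext-suc ρ Na) (cong (renN suc) ea)) (trans (renN-ext-suc ρ Nb) (cong (renN suc) eb)))

  renN-nbody-merge : ∀ ρ α β δ Na Nb Ns γ M → Merges ρ α β δ → Fresh β Na → renN ρ Na ≡ Ns → renN ρ Nb ≡ Ns →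
               renN ρ (nbody β Nb γ (nbody α Na γ M)) ≡ nbody δ Ns (ρ γ) (renN ρ M)
  renN-nbody-merge ρ α β δ Na Nb Ns γ M mc@(e1 , e2 , h , ne) nf ea eb with γ ≟ α | γ ≟ β | ρ γ ≟ δ
  ... | yes p | yes q | _ = ⊥-elim (ne (trans (sym p) q))
  ... | yes p | no q | yes r = cong₂ app (renN-napp-merge ρ α β δ Na Nb Ns M mc nf ea eb)
                                   (trans (cong (renN ρ) (napp-fresh β Nb Na nf)) ea)
  ... | yes p | no q | no r = ⊥-elim (r (trans (cong ρ p) e1))
  ... | no p | yes q | yes r = cong₂ app (renN-napp-merge ρ α β δ Na Nb Ns M mc nf ea eb) eb
  ... | no p | yes q | no r = ⊥-elim (r (trans (cong ρ q) e2))
  ... | no p | no q | yes r with h γ r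
  ...   | inj₁ x = ⊥-elim (p x)
  ...   | inj₂ x = ⊥-elim (q x)
  renN-nbody-merge ρ α β δ Na Nb Ns γ M mc nf ea eb | no p | no q | no r = renN-napp-merge ρ α β δ Na Nb Ns M mc nf ea eb

≡⇒↠ : ∀ {M N} → M ≡ N → M ↠ N
≡⇒↠ refl = ε

⟶-≡ : ∀ {M N N'} → M ⟶ N → N ≡ N' → M ⟶ N'
⟶-≡ s refl = s

lam↠ : ∀ {M M'} → M ↠ M' → lam M ↠ lam M'
lam↠ = gmap lam ξ-lam

mu↠ : ∀ {b M M'} → M ↠ M' → mu b M ↠ mu b M'
mu↠ {b} = gmap (mu b) ξ-mu

app↠ : ∀ {M M' N N'} → M ↠ M' → N ↠ N' → app M N ↠ app M' N'
app↠ {M} {M'} {N} {N'} p q = gmap (λ z → app z N) ξ-appL p ◅◅ gmap (app M') ξ-appR q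

sub-substT0 : ∀ σ N M → sub σ (substT 0 N M) ≡ substT 0 (sub σ N) (sub (exts σ) M)
sub-substT0 σ N M =
  trans (cong (sub σ) (substT≡sub 0 N M))
  (trans (sub-sub σ (substVar 0 N) M)
  (trans (sym (sub-cong h M))
  (trans (sym (sub-sub (substVar 0 (sub σ N)) (exts σ) M))
  (sym (substT≡sub 0 (sub σ N) (sub (exts σ) M))))))
  where
  h : ∀ x → sub (substVar 0 (sub σ N)) (exts σ x) ≡ sub σ (substVar 0 N x)
  h zero = refl
  h (suc y) = trans (sub-renV (substVar 0 (sub σ N)) suc (σ y)) (sub-id (λ x → refl) (σ y))

renN-contr-renN-suc : ∀ a X → renN (contr a) (renN suc X) ≡ X
renN-contr-renN-suc a X = trans (renN-renN (contr a) suc X) (renN-id (λ x → refl) X)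

sub-⟶ : ∀ σ {M M'} → M ⟶ M' → sub σ M ⟶ sub σ M'
sub-⟶ σ (β-red {M} {N}) = ⟶-≡ β-red (sym (sub-substT0 σ N M))
sub-⟶ σ (μ-red {b} {M} {N}) = ⟶-≡ μ-red (cong (mu b)
  (nbody-sub 0 (renN suc N) (renN suc (sub σ N)) (renN suc ∘ σ) (renN suc ∘ σ) b M
     (λ x → sym (napp-fresh 0 _ _ (renN-suc-fresh (σ x)))) (sym (renN-sub suc σ N))))
sub-⟶ σ (ρ-red {a} {e} {M}) = ⟶-≡ ρ-red (cong (mu (contr a e))
  (trans (renN-sub (contr a) _ M) (sub-cong (λ x → renN-contr-renN-suc a (renN suc (σ x))) (renN (contr a) M))))
sub-⟶ σ (ξ-lam s) = ξ-lam (sub-⟶ (exts σ) s)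
sub-⟶ σ (ξ-appL s) = ξ-appL (sub-⟶ σ s)
sub-⟶ σ (ξ-appR s) = ξ-appR (sub-⟶ σ s)
sub-⟶ σ (ξ-mu s) = ξ-mu (sub-⟶ (renN suc ∘ σ) s)

substT-⟶ : ∀ k N {M M'} → M ⟶ M' → substT k N M ⟶ substT k N M'
substT-⟶ k N {M} {M'} s rewrite substT≡sub k N M | substT≡sub k N M' = sub-⟶ (substVar k N) s

renV-substT0 : ∀ ρ N M → renV ρ (substT 0 N M) ≡ substT 0 (renV ρ N) (renV (ext ρ) M)
renV-substT0 ρ N M =
  trans (cong (renV ρ) (substT≡sub 0 N M))
  (trans (renV-sub ρ (substVar 0 N) M)
  (trans (sub-cong h M)
  (trans (sym (sub-renV (substVar 0 (renV ρ N)) (ext ρ) M))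
  (sym (substT≡sub 0 (renV ρ N) (renV (ext ρ) M))))))
  where
  h : ∀ x → renV ρ (substVar 0 N x) ≡ substVar 0 (renV ρ N) (ext ρ x)
  h zero = refl
  h (suc y) = refl

renV-⟶ : ∀ ρ {M M'} → M ⟶ M' → renV ρ M ⟶ renV ρ M'
renV-⟶ ρ (β-red {M} {N}) = ⟶-≡ β-red (sym (renV-substT0 ρ N M))
renV-⟶ ρ (μ-red {b} {M} {N}) = ⟶-≡ μ-red (cong (mu b)
  (trans (cong (λ z → nbody 0 z b (renV ρ M)) (sym (renV-renN ρ suc N))) (sym (renV-nbody ρ 0 (renN suc N) b M))))
renV-⟶ ρ (ρ-red {a} {e} {M}) = ⟶-≡ ρ-red (cong (mu (contr a e)) (sym (renV-renN ρ (contr a) M)))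
renV-⟶ ρ (ξ-lam s) = ξ-lam (renV-⟶ (ext ρ) s)
renV-⟶ ρ (ξ-appL s) = ξ-appL (renV-⟶ ρ s)
renV-⟶ ρ (ξ-appR s) = ξ-appR (renV-⟶ ρ s)
renV-⟶ ρ (ξ-mu s) = ξ-mu (renV-⟶ ρ s)

renN-substT0 : ∀ ρ N M → renN ρ (substT 0 N M) ≡ substT 0 (renN ρ N) (renN ρ M)
renN-substT0 ρ N M =
  trans (cong (renN ρ) (substT≡sub 0 N M))
  (trans (renN-sub ρ (substVar 0 N) M)
  (trans (sub-cong (λ x → renN-substVar ρ 0 N x) (renN ρ M))
  (sym (substT≡sub 0 (renN ρ N) (renN ρ M)))))

ext-injectiveAt-0 : ∀ ρ → InjectiveAt (ext ρ) 0
ext-injectiveAt-0 ρ zero e = refl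
ext-injectiveAt-0 ρ (suc i) ()

contr-ext : ∀ ρ a i → contr (ext ρ a) (ext (ext ρ) i) ≡ ext ρ (contr a i)
contr-ext ρ a zero = refl
contr-ext ρ a (suc i) = refl

renN-⟶ : ∀ ρ {M M'} → M ⟶ M' → renN ρ M ⟶ renN ρ M'
renN-⟶ ρ (β-red {M} {N}) = ⟶-≡ β-red (sym (renN-substT0 ρ N M))
renN-⟶ ρ (μ-red {b} {M} {N}) = ⟶-≡ μ-red (cong (mu (ext ρ b))
  (trans (cong (λ z → nbody 0 z (ext ρ b) (renN (ext ρ) M)) (sym (renN-ext-suc ρ N)))
         (sym (renN-nbody (ext ρ) 0 (renN suc N) b M (ext-injectiveAt-0 ρ)))))
renN-⟶ ρ (ρ-red {a} {e} {M}) = ⟶-≡ ρ-red (cong₂ mu (contr-ext ρ a e)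
  (trans (renN-renN (contr (ext ρ a)) (ext (ext ρ)) M)
  (trans (renN-cong (contr-ext ρ a) M) (sym (renN-renN (ext ρ) (contr a) M)))))
renN-⟶ ρ (ξ-lam s) = ξ-lam (renN-⟶ ρ s)
renN-⟶ ρ (ξ-appL s) = ξ-appL (renN-⟶ ρ s)
renN-⟶ ρ (ξ-appR s) = ξ-appR (renN-⟶ ρ s)
renN-⟶ ρ (ξ-mu s) = ξ-mu (renN-⟶ (ext ρ) s)

renV-↠ : ∀ ρ {M M'} → M ↠ M' → renV ρ M ↠ renV ρ M'
renV-↠ ρ = gmap (renV ρ) (renV-⟶ ρ)

renN-↠ : ∀ ρ {M M'} → M ↠ M' → renN ρ M ↠ renN ρ M'
renN-↠ ρ = gmap (renN ρ) (renN-⟶ ρ)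

sub-arg-↠ : ∀ {σ σ'} → (∀ x → σ x ↠ σ' x) → ∀ M → sub σ M ↠ sub σ' M
sub-arg-↠ h (var x) = h x
sub-arg-↠ {σ} {σ'} h (lam M) = lam↠ (sub-arg-↠ h' M)
  where
  h' : ∀ x → exts σ x ↠ exts σ' x
  h' zero = ε
  h' (suc x) = renV-↠ suc (h x)
sub-arg-↠ h (app M N) = app↠ (sub-arg-↠ h M) (sub-arg-↠ h N)
sub-arg-↠ h (mu b M) = mu↠ (sub-arg-↠ (λ x → renN-↠ suc (h x)) M)

substT0-↠ : ∀ {N N' M M'} → N ↠ N' → M ↠ M' → substT 0 N M ↠ substT 0 N' M'
substT0-↠ {N} {N'} {M} {M'} p q =
  gmap (substT 0 N) (substT-⟶ 0 N) q ◅◅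
  (≡⇒↠ (substT≡sub 0 N M') ◅◅ (sub-arg-↠ h M' ◅◅ ≡⇒↠ (sym (substT≡sub 0 N' M'))))
  where
  h : ∀ x → substVar 0 N x ↠ substVar 0 N' x
  h zero = p
  h (suc y) = ε

napp-substT0 : ∀ α N Y A → napp α N (substT 0 Y A) ≡ substT 0 (napp α N Y) (napp α (renV suc N) A)
napp-substT0 α N Y A = trans (cong (napp α N) (substT≡sub 0 Y A)) (trans
    (napp-sub α (renV suc N) N (substVar 0 Y) (substVar 0 (napp α N Y)) A napp-substVar substVar-renV-suc)
    (sym (substT≡sub 0 (napp α N Y) (napp α (renV suc N) A))))
  where
  napp-substVar : ∀ x → substVar 0 (napp α N Y) x ≡ napp α N (substVar 0 Y x)
  napp-substVar zero = refl
  napp-substVar (suc y) = refl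
  substVar-renV-suc : sub (substVar 0 (napp α N Y)) (renV suc N) ≡ N
  substVar-renV-suc = trans (sub-renV _ suc N) (sub-id (λ x → refl) N)

mutual
  napp-⟶ : ∀ α N {M M'} → M ⟶ M' → napp α N M ↠ napp α N M'
  napp-⟶ α N (β-red {A} {Q}) = return (⟶-≡ β-red (sym (napp-substT0 α N Q A)))
  napp-⟶ α N (μ-red {b} {A} {Q}) = return (⟶-≡ μ-red (cong (mu b)
    (trans (cong (λ z → nbody 0 z b (nbody (suc α) (renN suc N) b A)) (renN-napp suc α N Q (suc-injectiveAt α)))
    (sym (nbody-nbody (suc α) 0 (renN suc N) (renN suc Q) b A (λ ()) (renN-suc-fresh N))))))
  napp-⟶ α N (ρ-red {a} {e} {A}) with a ≟ suc α
  ... | no ne = return (⟶-≡ ρ-red (cong (mu (contr a e))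
         (trans (renN-nbody (contr a) (suc (suc α)) (renN suc (renN suc N)) e A inj)
                (cong (λ z → nbody (suc α) z (contr a e) (renN (contr a) A)) (renN-contr-renN-suc a (renN suc N))))))
    where
    inj : InjectiveAt (contr a) (suc (suc α))
    inj zero p = ⊥-elim (ne p)
    inj (suc i) p = cong suc p
  -- The outer jump is to α, so the named application creates a μ-redex, which
  -- has to be contracted before the ρ-step.
  ... | yes eq = ξ-mu μ-red ◅ (⟶-≡ ρ-red (cong (mu (contr a e))
         (renN-nbody-merge (contr a) (suc (suc α)) 0 (suc α) (renN suc (renN suc N)) (renN suc (renN suc N)) (renN suc N) e A
            (refl , eq , h , (λ ())) (renN-suc-fresh (renN suc N)) (renN-contr-renN-suc a _) (renN-contr-renN-suc a _))) ◅ ε)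
    where
    h : ∀ i → contr a i ≡ suc α → (i ≡ suc (suc α)) ⊎ (i ≡ 0)
    h zero p = inj₂ refl
    h (suc i) p = inj₁ (cong suc p)
  napp-⟶ α N (ξ-lam s) = lam↠ (napp-⟶ α (renV suc N) s)
  napp-⟶ α N (ξ-appL s) = app↠ (napp-⟶ α N s) ε
  napp-⟶ α N (ξ-appR s) = app↠ ε (napp-⟶ α N s)
  napp-⟶ α N (ξ-mu {b} s) = mu↠ (nbody-⟶ (suc α) (renN suc N) b s)

  nbody-⟶ : ∀ α N γ {M M'} → M ⟶ M' → nbody α N γ M ↠ nbody α N γ M'
  nbody-⟶ α N γ {M} {M'} s with γ ≟ α
  ... | yes _ = app↠ (napp-⟶ α N s) ε
  ... | no _ = napp-⟶ α N s

nbody-↠ : ∀ α N γ {M M'} → M ↠ M' → nbody α N γ M ↠ nbody α N γ M'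
nbody-↠ α N γ = kleisliStar (nbody α N γ) (nbody-⟶ α N γ)

mutual
  napp-arg-↠ : ∀ α {N N'} → N ↠ N' → ∀ M → napp α N M ↠ napp α N' M
  napp-arg-↠ α p (var x) = ε
  napp-arg-↠ α p (lam M) = lam↠ (napp-arg-↠ α (renV-↠ suc p) M)
  napp-arg-↠ α p (app M P) = app↠ (napp-arg-↠ α p M) (napp-arg-↠ α p P)
  napp-arg-↠ α p (mu γ M) = mu↠ (nbody-arg-↠ (suc α) (renN-↠ suc p) γ M)

  nbody-arg-↠ : ∀ α {N N'} → N ↠ N' → ∀ γ M → nbody α N γ M ↠ nbody α N' γ M
  nbody-arg-↠ α p γ M with γ ≟ α
  ... | yes _ = app↠ (napp-arg-↠ α p M) p
  ... | no _ = napp-arg-↠ α p M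

-- Complete developments

-- dev is a Z-function in the sense of Dehornoy and van Oostrom: M ⟶ N implies
-- N ↠ dev M ↠ dev N. devApp and devMu contract the redex, if any, that appears
-- at the root once the immediate subterms have been developed.
devMu : ℕ → Term → Term
devMu a (var x) = mu a (var x)
devMu a (lam Y) = mu a (lam Y)
devMu a (app Y Z) = mu a (app Y Z)
devMu a (mu e Y) = mu (contr a e) (renN (contr a) Y)

devApp : Term → Term → Term
devApp (var x) Y = app (var x) Y
devApp (lam A) Y = substT 0 Y A
devApp (app A B) Y = app (app A B) Y
devApp (mu b A) Y = mu b (nbody 0 (renN suc Y) b A)

devBody : ℕ → Term → ℕ → Term → Term
devBody α N γ X with γ ≟ α
... | yes _ = devApp (napp α N X) N
... | no _ = napp α N X

dev : Term → Term
dev (var x) = var x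
dev (lam M) = lam (dev M)
dev (app M N) = devApp (dev M) (dev N)
dev (mu a M) = devMu a (dev M)

mu↠devMu : ∀ a X → mu a X ↠ devMu a X
mu↠devMu a (var x) = ε
mu↠devMu a (lam X) = ε
mu↠devMu a (app X Y) = ε
mu↠devMu a (mu e X) = return ρ-red

app↠devApp : ∀ X Y → app X Y ↠ devApp X Y
app↠devApp (var x) Y = ε
app↠devApp (lam X) Y = return β-red
app↠devApp (app X Z) Y = ε
app↠devApp (mu b X) Y = return μ-red

↠dev : ∀ M → M ↠ dev M
↠dev (var x) = ε
↠dev (lam M) = lam↠ (↠dev M)
↠dev (app M N) = app↠ (↠dev M) (↠dev N) ◅◅ app↠devApp (dev M) (dev N)
↠dev (mu a M) = mu↠ (↠dev M) ◅◅ mu↠devMu a (dev M)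

contr-contr : ∀ a e i → contr (contr a e) (ext (contr a) i) ≡ contr a (contr e i)
contr-contr a e zero = refl
contr-contr a e (suc i) = refl

renN-contr-contr : ∀ a e Z → renN (contr (contr a e)) (renN (ext (contr a)) Z) ≡ renN (contr a) (renN (contr e) Z)
renN-contr-contr a e Z = trans (renN-renN _ _ Z) (trans (renN-cong (contr-contr a e) Z) (sym (renN-renN _ _ Z)))

devMu-devMu : ∀ a e X → devMu a (devMu e X) ≡ devMu (contr a e) (renN (contr a) X)
devMu-devMu a e (var x) = refl
devMu-devMu a e (lam X) = refl
devMu-devMu a e (app X Y) = refl
devMu-devMu a e (mu f Z) = sym (cong₂ mu (contr-contr a e f) (renN-contr-contr a e Z))

devMu-⟶ : ∀ a {X X'} → X ⟶ X' → devMu a X ↠ devMu a X'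
devMu-⟶ a {mu e Y} (ξ-mu s) = return (ξ-mu (renN-⟶ (contr a) s))
devMu-⟶ a {mu e (mu f Z)} ρ-red = ρ-red ◅ ≡⇒↠ (cong₂ mu (contr-contr a e f) (renN-contr-contr a e Z))
devMu-⟶ a {var x} ()
devMu-⟶ a {lam Y} {X'} s = ξ-mu s ◅ mu↠devMu a X'
devMu-⟶ a {app Y Z} {X'} s = ξ-mu s ◅ mu↠devMu a X'

devMu-↠ : ∀ a {X X'} → X ↠ X' → devMu a X ↠ devMu a X'
devMu-↠ a = kleisliStar (devMu a) (devMu-⟶ a)

renN-contr-nbody-bound : ∀ β N1 γ e Y → γ ≡ β →
  renN (contr γ) (nbody 0 (renN suc N1) e (nbody (suc β) (renN suc N1) e Y)) ≡ nbody β N1 (contr γ e) (renN (contr γ) Y)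
renN-contr-nbody-bound β N1 γ e Y eq = renN-nbody-merge (contr γ) (suc β) 0 β (renN suc N1) (renN suc N1) N1 e Y
  (refl , eq , h , (λ ())) (renN-suc-fresh N1) (renN-contr-renN-suc γ N1) (renN-contr-renN-suc γ N1)
  where
  h : ∀ i → contr γ i ≡ β → (i ≡ suc β) ⊎ (i ≡ 0)
  h zero p = inj₂ refl
  h (suc i) p = inj₁ (cong suc p)

renN-contr-nbody-free : ∀ β N1 γ e Y → γ ≢ β →
  renN (contr γ) (nbody (suc β) (renN suc N1) e Y) ≡ nbody β N1 (contr γ e) (renN (contr γ) Y)
renN-contr-nbody-free β N1 γ e Y ne = trans (renN-nbody (contr γ) (suc β) (renN suc N1) e Y inj)
  (cong (λ z → nbody β z (contr γ e) (renN (contr γ) Y)) (renN-contr-renN-suc γ N1))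
  where
  inj : InjectiveAt (contr γ) (suc β)
  inj zero p = ⊥-elim (ne p)
  inj (suc i) p = cong suc p

devApp-ρ : ∀ b e Z Y → devApp (mu b (mu e Z)) Y ↠ devApp (mu (contr b e) (renN (contr b) Z)) Y
devApp-ρ b e Z Y with b ≟ 0
... | yes eq = ξ-mu μ-red ◅ (⟶-≡ ρ-red (cong (mu (contr b e)) (renN-contr-nbody-bound 0 (renN suc Y) b e Z eq)) ◅ ε)
... | no ne = return (⟶-≡ ρ-red (cong (mu (contr b e)) (renN-contr-nbody-free 0 (renN suc Y) b e Z ne)))

devApp-⟶ˡ : ∀ {X X'} Y → X ⟶ X' → devApp X Y ↠ devApp X' Y
devApp-⟶ˡ {lam A} Y (ξ-lam s) = substT0-↠ ε (return s)
devApp-⟶ˡ {mu b A} Y (ξ-mu s) = mu↠ (nbody-↠ 0 (renN suc Y) b (return s))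
devApp-⟶ˡ {mu b (mu e Z)} Y ρ-red = devApp-ρ b e Z Y
devApp-⟶ˡ {var x} Y ()
devApp-⟶ˡ {app A B} {X'} Y s = ξ-appL s ◅ app↠devApp X' Y

devApp-↠ˡ : ∀ {X X'} Y → X ↠ X' → devApp X Y ↠ devApp X' Y
devApp-↠ˡ Y = kleisliStar (λ z → devApp z Y) (devApp-⟶ˡ Y)

devApp-↠ʳ : ∀ X {Y Y'} → Y ↠ Y' → devApp X Y ↠ devApp X Y'
devApp-↠ʳ (var x) p = app↠ ε p
devApp-↠ʳ (lam A) p = substT0-↠ {M = A} p ε
devApp-↠ʳ (app A B) p = app↠ ε p
devApp-↠ʳ (mu b A) p = mu↠ (nbody-arg-↠ 0 (renN-↠ suc p) b A)

devApp-↠ : ∀ {X X' Y Y'} → X ↠ X' → Y ↠ Y' → devApp X Y ↠ devApp X' Y'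
devApp-↠ {X} {X'} {Y} p q = devApp-↠ˡ Y p ◅◅ devApp-↠ʳ X' q

devMu-devBody-mu : ∀ β N1 γ e Y → devMu γ (devBody β N1 γ (mu e Y)) ≡ mu (contr γ e) (nbody β N1 (contr γ e) (renN (contr γ) Y))
devMu-devBody-mu β N1 γ e Y with γ ≟ β
... | yes eq = cong (mu (contr γ e)) (renN-contr-nbody-bound β N1 γ e Y eq)
... | no ne = cong (mu (contr γ e)) (renN-contr-nbody-free β N1 γ e Y ne)

mu-nbody↠devMu : ∀ β N1 γ X → mu γ (nbody β N1 γ X) ↠ devMu γ (devBody β N1 γ X)
mu-nbody↠devMu β N1 γ X with γ ≟ β
... | yes _ = mu↠ (app↠devApp (napp β N1 X) N1) ◅◅ mu↠devMu γ _
... | no _ = mu↠devMu γ _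

napp-devMu : ∀ α N γ X → napp α N (devMu γ X) ↠ devMu γ (devBody (suc α) (renN suc N) γ X)
napp-devMu α N γ (var x) = mu-nbody↠devMu (suc α) (renN suc N) γ (var x)
napp-devMu α N γ (lam X) = mu-nbody↠devMu (suc α) (renN suc N) γ (lam X)
napp-devMu α N γ (app X Y) = mu-nbody↠devMu (suc α) (renN suc N) γ (app X Y)
napp-devMu α N γ (mu e Y) = ≡⇒↠ (sym (devMu-devBody-mu (suc α) (renN suc N) γ e Y))

devApp-devMu : ∀ b X Y → devApp (devMu b X) Y ↠ devMu b (devBody 0 (renN suc Y) b X)
devApp-devMu b (var x) Y = mu-nbody↠devMu 0 (renN suc Y) b (var x)
devApp-devMu b (lam X) Y = mu-nbody↠devMu 0 (renN suc Y) b (lam X)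
devApp-devMu b (app X Z) Y = mu-nbody↠devMu 0 (renN suc Y) b (app X Z)
devApp-devMu b (mu e Z) Y = ≡⇒↠ (sym (devMu-devBody-mu 0 (renN suc Y) b e Z))

renV-devMu : ∀ ρ a X → renV ρ (devMu a X) ≡ devMu a (renV ρ X)
renV-devMu ρ a (var x) = refl
renV-devMu ρ a (lam X) = refl
renV-devMu ρ a (app X Y) = refl
renV-devMu ρ a (mu e Y) = cong (mu (contr a e)) (renV-renN ρ (contr a) Y)

renV-devApp : ∀ ρ X Y → renV ρ (devApp X Y) ≡ devApp (renV ρ X) (renV ρ Y)
renV-devApp ρ (var x) Y = refl
renV-devApp ρ (lam A) Y = renV-substT0 ρ Y A
renV-devApp ρ (app A B) Y = refl
renV-devApp ρ (mu b A) Y = cong (mu b) (trans (renV-nbody ρ 0 (renN suc Y) b A)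
  (cong (λ z → nbody 0 z b (renV ρ A)) (renV-renN ρ suc Y)))

renV-dev : ∀ ρ M → renV ρ (dev M) ≡ dev (renV ρ M)
renV-dev ρ (var x) = refl
renV-dev ρ (lam M) = cong lam (renV-dev (ext ρ) M)
renV-dev ρ (app M N) = trans (renV-devApp ρ (dev M) (dev N)) (cong₂ devApp (renV-dev ρ M) (renV-dev ρ N))
renV-dev ρ (mu a M) = trans (renV-devMu ρ a (dev M)) (cong (devMu a) (renV-dev ρ M))

renN-devMu : ∀ ρ a X → renN ρ (devMu a X) ≡ devMu (ext ρ a) (renN (ext ρ) X)
renN-devMu ρ a (var x) = refl
renN-devMu ρ a (lam X) = refl
renN-devMu ρ a (app X Y) = refl
renN-devMu ρ a (mu e Y) = cong₂ mu (sym (contr-ext ρ a e))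
  (trans (renN-renN (ext ρ) (contr a) Y) (trans (sym (renN-cong (contr-ext ρ a) Y)) (sym (renN-renN _ _ Y))))

renN-devApp : ∀ ρ X Y → renN ρ (devApp X Y) ≡ devApp (renN ρ X) (renN ρ Y)
renN-devApp ρ (var x) Y = refl
renN-devApp ρ (lam A) Y = renN-substT0 ρ Y A
renN-devApp ρ (app A B) Y = refl
renN-devApp ρ (mu b A) Y = cong (mu (ext ρ b)) (trans (renN-nbody (ext ρ) 0 (renN suc Y) b A (ext-injectiveAt-0 ρ))
  (cong (λ z → nbody 0 z (ext ρ b) (renN (ext ρ) A)) (renN-ext-suc ρ Y)))

renN-dev : ∀ ρ M → renN ρ (dev M) ≡ dev (renN ρ M)
renN-dev ρ (var x) = refl
renN-dev ρ (lam M) = cong lam (renN-dev ρ M)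
renN-dev ρ (app M N) = trans (renN-devApp ρ (dev M) (dev N)) (cong₂ devApp (renN-dev ρ M) (renN-dev ρ N))
renN-dev ρ (mu a M) = trans (renN-devMu ρ a (dev M)) (cong (devMu (ext ρ a)) (renN-dev (ext ρ) M))

sub-devApp : ∀ τ X Y → sub τ (devApp X Y) ↠ devApp (sub τ X) (sub τ Y)
sub-devApp τ (var x) Y = app↠devApp (τ x) (sub τ Y)
sub-devApp τ (lam A) Y = ≡⇒↠ (sub-substT0 τ Y A)
sub-devApp τ (app A B) Y = ε
sub-devApp τ (mu b A) Y = ≡⇒↠ (cong (mu b) (sym
  (nbody-sub 0 (renN suc Y) (renN suc (sub τ Y)) (renN suc ∘ τ) (renN suc ∘ τ) b A
     (λ x → sym (napp-fresh 0 _ _ (renN-suc-fresh (τ x)))) (sym (renN-sub suc τ Y)))))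

sub-devMu : ∀ τ a X → sub τ (devMu a X) ↠ devMu a (sub (renN suc ∘ τ) X)
sub-devMu τ a (var x) = mu↠devMu a (renN suc (τ x))
sub-devMu τ a (lam X) = ε
sub-devMu τ a (app X Y) = ε
sub-devMu τ a (mu e Y) = ≡⇒↠ (cong (mu (contr a e)) (sym
  (trans (renN-sub (contr a) _ Y) (sub-cong (λ x → renN-contr-renN-suc a (renN suc (τ x))) (renN (contr a) Y)))))

sub-dev : ∀ τ σ M → (∀ x → τ x ≡ dev (σ x)) → sub τ (dev M) ↠ dev (sub σ M)
sub-dev τ σ (var x) h = ≡⇒↠ (h x)
sub-dev τ σ (lam M) h = lam↠ (sub-dev (exts τ) (exts σ) M h')
  where
  h' : ∀ x → exts τ x ≡ dev (exts σ x)
  h' zero = refl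
  h' (suc y) = trans (cong (renV suc) (h y)) (renV-dev suc (σ y))
sub-dev τ σ (app M N) h = sub-devApp τ (dev M) (dev N) ◅◅ devApp-↠ (sub-dev τ σ M h) (sub-dev τ σ N h)
sub-dev τ σ (mu a M) h = sub-devMu τ a (dev M) ◅◅ devMu-↠ a (sub-dev (renN suc ∘ τ) (renN suc ∘ σ) M
  (λ x → trans (cong (renN suc) (h x)) (renN-dev suc (σ x))))

napp-devApp : ∀ α N X Y → napp α N (devApp X Y) ↠ devApp (napp α N X) (napp α N Y)
napp-devApp α N (var x) Y = ε
napp-devApp α N (lam A) Y = ≡⇒↠ (napp-substT0 α N Y A)
napp-devApp α N (app A B) Y = ε
napp-devApp α N (mu b A) Y = ≡⇒↠ (cong (mu b)
    (trans (nbody-nbody (suc α) 0 (renN suc N) (renN suc Y) b A (λ ()) (renN-suc-fresh N))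
    (cong (λ z → nbody 0 z b (nbody (suc α) (renN suc N) b A)) (sym (renN-napp suc α N Y (suc-injectiveAt α))))))

mutual
  napp-dev : ∀ α N M → napp α (dev N) (dev M) ↠ dev (napp α N M)
  napp-dev α N (var x) = ε
  napp-dev α N (lam M) = ≡⇒↠ (cong (λ z → lam (napp α z (dev M))) (renV-dev suc N)) ◅◅ lam↠ (napp-dev α (renV suc N) M)
  napp-dev α N (app M P) = napp-devApp α (dev N) (dev M) (dev P) ◅◅ devApp-↠ (napp-dev α N M) (napp-dev α N P)
  napp-dev α N (mu γ M) = napp-devMu α (dev N) γ (dev M) ◅◅
    (≡⇒↠ (cong (λ z → devMu γ (devBody (suc α) z γ (dev M))) (renN-dev suc N)) ◅◅
     devMu-↠ γ (devBody-dev (suc α) (renN suc N) γ M))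

  devBody-dev : ∀ α N γ M → devBody α (dev N) γ (dev M) ↠ dev (nbody α N γ M)
  devBody-dev α N γ M with γ ≟ α
  ... | yes _ = devApp-↠ˡ (dev N) (napp-dev α N M)
  ... | no _ = napp-dev α N M

⟶⇒↠dev : ∀ {M N} → M ⟶ N → N ↠ dev M
⟶⇒↠dev (β-red {A} {Q}) = substT0-↠ (↠dev Q) (↠dev A)
⟶⇒↠dev (μ-red {b} {A} {Q}) = mu↠ (nbody-arg-↠ 0 (renN-↠ suc (↠dev Q)) b A ◅◅ nbody-↠ 0 (renN suc (dev Q)) b (↠dev A))
  ◅◅ devApp-↠ˡ (dev Q) (mu↠devMu b (dev A))
⟶⇒↠dev (ρ-red {a} {e} {A}) = mu↠ (renN-↠ (contr a) (↠dev A)) ◅◅ (mu↠devMu (contr a e) (renN (contr a) (dev A)) ◅◅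
  ≡⇒↠ (sym (devMu-devMu a e (dev A))))
⟶⇒↠dev (ξ-lam s) = lam↠ (⟶⇒↠dev s)
⟶⇒↠dev (ξ-appL {M} {M'} {N} s) = app↠ (⟶⇒↠dev s) (↠dev N) ◅◅ app↠devApp _ _
⟶⇒↠dev (ξ-appR {M} s) = app↠ (↠dev M) (⟶⇒↠dev s) ◅◅ app↠devApp _ _
⟶⇒↠dev (ξ-mu {b} s) = mu↠ (⟶⇒↠dev s) ◅◅ mu↠devMu b _

dev-⟶ : ∀ {M N} → M ⟶ N → dev M ↠ dev N
dev-⟶ (β-red {A} {Q}) = ≡⇒↠ (substT≡sub 0 (dev Q) (dev A)) ◅◅ (sub-dev (substVar 0 (dev Q)) (substVar 0 Q) A h ◅◅
     ≡⇒↠ (cong dev (sym (substT≡sub 0 Q A))))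
  where
  h : ∀ x → substVar 0 (dev Q) x ≡ dev (substVar 0 Q x)
  h zero = refl
  h (suc y) = refl
dev-⟶ (μ-red {b} {A} {Q}) = devApp-devMu b (dev A) (dev Q) ◅◅
  (≡⇒↠ (cong (λ z → devMu b (devBody 0 z b (dev A))) (renN-dev suc Q)) ◅◅ devMu-↠ b (devBody-dev 0 (renN suc Q) b A))
dev-⟶ (ρ-red {a} {e} {A}) = ≡⇒↠ (trans (devMu-devMu a e (dev A)) (cong (devMu (contr a e)) (renN-dev (contr a) A)))
dev-⟶ (ξ-lam s) = lam↠ (dev-⟶ s)
dev-⟶ (ξ-appL {M} {M'} {N} s) = devApp-↠ˡ (dev N) (dev-⟶ s)
dev-⟶ (ξ-appR {M} s) = devApp-↠ʳ (dev M) (dev-⟶ s)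
dev-⟶ (ξ-mu {b} s) = devMu-↠ b (dev-⟶ s)

dev-↠ : ∀ {M N} → M ↠ N → dev M ↠ dev N
dev-↠ = kleisliStar dev dev-⟶

devⁿ : ℕ → Term → Term
devⁿ zero M = M
devⁿ (suc k) M = devⁿ k (dev M)

devⁿ-↠ : ∀ k {M N} → M ↠ N → devⁿ k M ↠ devⁿ k N
devⁿ-↠ zero p = p
devⁿ-↠ (suc k) p = devⁿ-↠ k (dev-↠ p)

⟶-devⁿ↠devⁿ⁺¹ : ∀ k {M M'} → M ⟶ M' → devⁿ k M' ↠ devⁿ (suc k) M
⟶-devⁿ↠devⁿ⁺¹ k s = devⁿ-↠ k (⟶⇒↠dev s)

devⁿ-mono-↠ : ∀ {k j} M → k ≤′ j → devⁿ k M ↠ devⁿ j M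
devⁿ-mono-↠ M (≤′-reflexive refl) = ε
devⁿ-mono-↠ M (≤′-step {n = j} k≤j) = devⁿ-mono-↠ M k≤j ◅◅ devⁿ-↠ j (↠dev M)

devⁿ-lam : ∀ k M → lam (devⁿ k M) ≡ devⁿ k (lam M)
devⁿ-lam zero M = refl
devⁿ-lam (suc k) M = devⁿ-lam k (dev M)

devⁿ-app : ∀ k M N → app (devⁿ k M) (devⁿ k N) ↠ devⁿ k (app M N)
devⁿ-app zero M N = ε
devⁿ-app (suc k) M N = devⁿ-app k (dev M) (dev N) ◅◅ devⁿ-↠ k (app↠devApp (dev M) (dev N))

devⁿ-mu : ∀ k b M → mu b (devⁿ k M) ↠ devⁿ k (mu b M)
devⁿ-mu zero b M = ε
devⁿ-mu (suc k) b M = devⁿ-mu k b (dev M) ◅◅ devⁿ-↠ k (mu↠devMu b (dev M))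

↠devⁿ : ∀ k M → M ↠ devⁿ k M
↠devⁿ zero M = ε
↠devⁿ (suc k) M = ↠dev M ◅◅ ↠devⁿ k (dev M)

-- Taylor expansion up to reduction

concatMap⁺ : ∀ {A B : Set} {P : A → Set} {Q : B → Set} {f : A → List B} →
             (∀ {x} → P x → All Q (f x)) → ∀ {xs} → All P xs → All Q (concatMap f xs)
concatMap⁺ g = concat⁺ ∘ gmap⁺ g

splits2-All : ∀ {Q : RTerm → Set} {B} → All Q B → All (λ p → All Q (proj₁ p) × All Q (proj₂ p)) (splits2 B)
splits2-All [] = ([] , []) ∷ []
splits2-All {Q} (q ∷ qs) = concatMap⁺ (λ { (a , b) → (q ∷ a , b) ∷ (a , q ∷ b) ∷ [] }) (splits2-All qs)

-- t ◁ M: t ∈ 𝒯(M) up to λμ-reduction, which (c-red) may be performed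
-- independently below each resource constructor, e.g. separately for each
-- element of a bag.
infix 4 _◁_

data _◁_ : RTerm → Term → Set where
  c-var : ∀ {x} → rvar x ◁ var x
  c-lam : ∀ {t M} → t ◁ M → rlam t ◁ lam M
  c-mu  : ∀ {b t M} → t ◁ M → rmu b t ◁ mu b M
  c-app : ∀ {t us M N} → t ◁ M → All (_◁ N) us → rapp t us ◁ app M N
  c-red : ∀ {t M M'} → M ⟶ M' → t ◁ M' → t ◁ M

◁-↠ : ∀ {t M M'} → M ↠ M' → t ◁ M' → t ◁ M
◁-↠ ε d = d
◁-↠ (s ◅ ss) d = c-red s (◁-↠ ss d)

mutual
  ∈𝒯⇒◁ : ∀ {t M} → t ∈𝒯 M → t ◁ M
  ∈𝒯⇒◁ 𝒯-var = c-var
  ∈𝒯⇒◁ (𝒯-lam p) = c-lam (∈𝒯⇒◁ p)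
  ∈𝒯⇒◁ (𝒯-mu p) = c-mu (∈𝒯⇒◁ p)
  ∈𝒯⇒◁ (𝒯-app p ps) = c-app (∈𝒯⇒◁ p) (All-∈𝒯⇒◁ ps)

  All-∈𝒯⇒◁ : ∀ {us N} → All (_∈𝒯 N) us → All (_◁ N) us
  All-∈𝒯⇒◁ [] = []
  All-∈𝒯⇒◁ (p ∷ ps) = ∈𝒯⇒◁ p ∷ All-∈𝒯⇒◁ ps

rlam-◁-inv : ∀ {t M} → rlam t ◁ M → ∃[ M0 ] (M ↠ lam M0 × t ◁ M0)
rlam-◁-inv (c-lam d) = _ , ε , d
rlam-◁-inv (c-red s d) with rlam-◁-inv d
... | M0 , p , d0 = M0 , s ◅ p , d0

rmu-◁-inv : ∀ {e t M} → rmu e t ◁ M → ∃[ M0 ] (M ↠ mu e M0 × t ◁ M0)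
rmu-◁-inv (c-mu d) = _ , ε , d
rmu-◁-inv (c-red s d) with rmu-◁-inv d
... | M0 , p , d0 = M0 , s ◅ p , d0

mutual
  renVR-◁ : ∀ ρ {t M} → t ◁ M → renVR ρ t ◁ renV ρ M
  renVR-◁ ρ c-var = c-var
  renVR-◁ ρ (c-lam d) = c-lam (renVR-◁ (ext ρ) d)
  renVR-◁ ρ (c-mu d) = c-mu (renVR-◁ ρ d)
  renVR-◁ ρ (c-app d ds) = c-app (renVR-◁ ρ d) (renVB-◁ ρ ds)
  renVR-◁ ρ (c-red s d) = c-red (renV-⟶ ρ s) (renVR-◁ ρ d)

  renVB-◁ : ∀ ρ {us N} → All (_◁ N) us → All (_◁ renV ρ N) (renVB ρ us)
  renVB-◁ ρ [] = []
  renVB-◁ ρ (d ∷ ds) = renVR-◁ ρ d ∷ renVB-◁ ρ ds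

mutual
  renNR-◁ : ∀ ρ {t M} → t ◁ M → renNR ρ t ◁ renN ρ M
  renNR-◁ ρ c-var = c-var
  renNR-◁ ρ (c-lam d) = c-lam (renNR-◁ ρ d)
  renNR-◁ ρ (c-mu d) = c-mu (renNR-◁ (ext ρ) d)
  renNR-◁ ρ (c-app d ds) = c-app (renNR-◁ ρ d) (renNB-◁ ρ ds)
  renNR-◁ ρ (c-red s d) = c-red (renN-⟶ ρ s) (renNR-◁ ρ d)

  renNB-◁ : ∀ ρ {us N} → All (_◁ N) us → All (_◁ renN ρ N) (renNB ρ us)
  renNB-◁ ρ [] = []
  renNB-◁ ρ (d ∷ ds) = renNR-◁ ρ d ∷ renNB-◁ ρ ds

onlyEmpty-All : ∀ {A : Set} {Q : A → Set} (B : Bag) {x} → Q x → All Q (onlyEmpty B x)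
onlyEmpty-All [] q = q ∷ []
onlyEmpty-All (_ ∷ _) q = []

lsubVar-◁ : ∀ k {B P} y → All (_◁ P) B → All (_◁ substVar k P y) (lsubVar k B y)
lsubVar-◁ k {B} y ds with compare k y
... | less _ m = onlyEmpty-All B c-var
... | greater _ _ = onlyEmpty-All B c-var
... | equal _ = h ds
  where
  h : ∀ {B P} → All (_◁ P) B → All (_◁ P) (single B)
  h [] = []
  h (d ∷ []) = d ∷ []
  h (d ∷ d' ∷ ds) = []

mutual
  lsub-◁ : ∀ k {B P t M} → t ◁ M → All (_◁ P) B → All (_◁ substT k P M) (lsub k B t)
  lsub-◁ k (c-var {y}) ds = lsubVar-◁ k y ds
  lsub-◁ k (c-lam d) ds = gmap⁺ c-lam (lsub-◁ (suc k) d (renVB-◁ suc ds))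
  lsub-◁ k (c-mu {b} d) ds = gmap⁺ c-mu (lsub-◁ k d (renNB-◁ suc ds))
  lsub-◁ k {B} (c-app {t} {vs} d es) ds =
    concatMap⁺ (λ { (d1 , d2) → concatMap⁺ (λ d' → gmap⁺ (c-app d') (lsubB-◁ k es d2)) (lsub-◁ k d d1) }) (splits2-All ds)
  lsub-◁ k (c-red s d) ds = All.map (c-red (substT-⟶ k _ s)) (lsub-◁ k d ds)

  lsubB-◁ : ∀ k {B P vs N} → All (_◁ N) vs → All (_◁ P) B → All (All (_◁ substT k P N)) (lsubB k B vs)
  lsubB-◁ k {B} [] ds = onlyEmpty-All B []
  lsubB-◁ k (e ∷ es) ds =
    concatMap⁺ (λ { (d1 , d2) → concatMap⁺ (λ d' → gmap⁺ (d' ∷_) (lsubB-◁ k es d2)) (lsub-◁ k e d1) }) (splits2-All ds)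

mutual
  napR-◁ : ∀ α {B P t M} → t ◁ M → All (_◁ P) B → All (_◁ napp α P M) (napR α B t)
  napR-◁ α {B} c-var ds = onlyEmpty-All B c-var
  napR-◁ α (c-lam d) ds = gmap⁺ c-lam (napR-◁ α d (renVB-◁ suc ds))
  napR-◁ α (c-mu {γ} d) ds = gmap⁺ c-mu (nbodyR-◁ (suc α) γ d (renNB-◁ suc ds))
  napR-◁ α (c-app d es) ds =
    concatMap⁺ (λ { (d1 , d2) → concatMap⁺ (λ d' → gmap⁺ (c-app d') (napB-◁ α es d2)) (napR-◁ α d d1) }) (splits2-All ds)
  napR-◁ α (c-red s d) ds = All.map (◁-↠ (napp-⟶ α _ s)) (napR-◁ α d ds)

  napB-◁ : ∀ α {B P vs N} → All (_◁ N) vs → All (_◁ P) B → All (All (_◁ napp α P N)) (napB α B vs)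
  napB-◁ α {B} [] ds = onlyEmpty-All B []
  napB-◁ α (e ∷ es) ds =
    concatMap⁺ (λ { (d1 , d2) → concatMap⁺ (λ d' → gmap⁺ (d' ∷_) (napB-◁ α es d2)) (napR-◁ α e d1) }) (splits2-All ds)

  nbodyR-◁ : ∀ α γ {B P t M} → t ◁ M → All (_◁ P) B → All (_◁ nbody α P γ M) (nbodyR α B γ t)
  nbodyR-◁ α γ d ds with γ ≟ α
  ... | yes _ = concatMap⁺ (λ { (d1 , d2) → gmap⁺ (λ d' → c-app d' d2) (napR-◁ α d d1) }) (splits2-All ds)
  ... | no _ = napR-◁ α d ds

All-++-∷⁻ : ∀ {Q : RTerm → Set} L {t R} → All Q (L ++ t ∷ R) → All Q L × Q t × All Q R
All-++-∷⁻ L qs with ++⁻ L qs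
... | a , (q ∷ b) = a , q , b

◁-⟶r : ∀ {t M T} → t ◁ M → t ⟶r T → All (_◁ M) T
◁-⟶r (c-red s d) st = All.map (c-red s) (◁-⟶r d st)
◁-⟶r c-var ()
◁-⟶r (c-lam d) (ξ-rlam st) = gmap⁺ c-lam (◁-⟶r d st)
◁-⟶r (c-mu d) (ξ-rmu st) = gmap⁺ c-mu (◁-⟶r d st)
◁-⟶r (c-mu {a} d) ρ-r with rmu-◁-inv d
... | M0 , p , d0 = ◁-↠ (mu↠ p ◅◅ return ρ-red) (c-mu (renNR-◁ (contr a) d0)) ∷ []
◁-⟶r (c-app d ds) β-r with rlam-◁-inv d
... | M0 , p , d0 = All.map (◁-↠ (app↠ p ε ◅◅ return β-red)) (lsub-◁ 0 d0 ds)
◁-⟶r (c-app d ds) (μ-r {b}) with rmu-◁-inv d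
... | M0 , p , d0 = All.map (◁-↠ (app↠ p ε ◅◅ return μ-red)) (gmap⁺ c-mu (nbodyR-◁ 0 b d0 (renNB-◁ suc ds)))
◁-⟶r (c-app d ds) (ξ-rappL st) = gmap⁺ (λ d' → c-app d' ds) (◁-⟶r d st)
◁-⟶r (c-app d ds) (ξ-rappR L R st) with All-++-∷⁻ L ds
... | a , q , b = gmap⁺ (λ d' → c-app d (++⁺ a (d' ∷ b))) (◁-⟶r q st)

infix 4 _↝_

_↝_ : RTerm → RTerm → Set
t ↝ u = ∃[ T ] (t ⟶r T × u ∈ T)

◁-↝ : ∀ {t u M} → t ◁ M → t ↝ u → u ◁ M
◁-↝ t◁M (_ , st , u∈T) = lookup (◁-⟶r t◁M st) u∈T

Normal : RTerm → Set
Normal t = ∀ T → ¬ (t ⟶r T)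

Normal-rlam : ∀ {t} → Normal (rlam t) → Normal t
Normal-rlam n T st = n _ (ξ-rlam st)

Normal-rmu : ∀ {b t} → Normal (rmu b t) → Normal t
Normal-rmu n T st = n _ (ξ-rmu st)

Normal-rappˡ : ∀ {t B} → Normal (rapp t B) → Normal t
Normal-rappˡ n T st = n _ (ξ-rappL st)

Normal-rapp-bag′ : ∀ {s} L B → Normal (rapp s (L ++ B)) → All Normal B
Normal-rapp-bag′ L [] n = []
Normal-rapp-bag′ {s} L (v ∷ R) n = (λ T st → n _ (ξ-rappR L R st)) ∷
  Normal-rapp-bag′ (L ++ [ v ]) R (subst (λ z → Normal (rapp s z)) (sym (++-assoc L [ v ] R)) n)

Normal-rapp-bag : ∀ {s B} → Normal (rapp s B) → All Normal B
Normal-rapp-bag {B = B} n = Normal-rapp-bag′ [] B n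

-- A λμ-redex of M at a position represented in s would be a resource redex of s.
mutual
  normal-∈𝒯-⟶ : ∀ {s M N} → Normal s → s ∈𝒯 M → M ⟶ N → s ∈𝒯 N
  normal-∈𝒯-⟶ n (𝒯-app (𝒯-lam p) ps) β-red = ⊥-elim (n _ β-r)
  normal-∈𝒯-⟶ n (𝒯-app (𝒯-mu p) ps) μ-red = ⊥-elim (n _ μ-r)
  normal-∈𝒯-⟶ n (𝒯-mu (𝒯-mu p)) ρ-red = ⊥-elim (n _ ρ-r)
  normal-∈𝒯-⟶ n (𝒯-lam p) (ξ-lam s) = 𝒯-lam (normal-∈𝒯-⟶ (Normal-rlam n) p s)
  normal-∈𝒯-⟶ n (𝒯-app p ps) (ξ-appL s) = 𝒯-app (normal-∈𝒯-⟶ (Normal-rappˡ n) p s) ps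
  normal-∈𝒯-⟶ n (𝒯-app p ps) (ξ-appR s) = 𝒯-app p (normal-All∈𝒯-⟶ (Normal-rapp-bag n) ps s)
  normal-∈𝒯-⟶ n (𝒯-mu p) (ξ-mu s) = 𝒯-mu (normal-∈𝒯-⟶ (Normal-rmu n) p s)

  normal-All∈𝒯-⟶ : ∀ {us M N} → All Normal us → All (_∈𝒯 M) us → M ⟶ N → All (_∈𝒯 N) us
  normal-All∈𝒯-⟶ [] [] s = []
  normal-All∈𝒯-⟶ (n ∷ ns) (p ∷ ps) s = normal-∈𝒯-⟶ n p s ∷ normal-All∈𝒯-⟶ ns ps s

normal-∈𝒯-↠ : ∀ {s M N} → Normal s → s ∈𝒯 M → M ↠ N → s ∈𝒯 N
normal-∈𝒯-↠ n p ε = p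
normal-∈𝒯-↠ n p (s ◅ ss) = normal-∈𝒯-↠ n (normal-∈𝒯-⟶ n p s) ss

normal-∈𝒯devⁿ-mono : ∀ {s M k j} → Normal s → s ∈𝒯 devⁿ k M → k ≤ j → s ∈𝒯 devⁿ j M
normal-∈𝒯devⁿ-mono {M = M} n s∈𝒯 k≤j = normal-∈𝒯-↠ n s∈𝒯 (devⁿ-mono-↠ M (≤⇒≤′ k≤j))

normal-All∈𝒯devⁿ-mono : ∀ {us M k j} → All Normal us → All (_∈𝒯 devⁿ k M) us → k ≤ j → All (_∈𝒯 devⁿ j M) us
normal-All∈𝒯devⁿ-mono [] [] le = []
normal-All∈𝒯devⁿ-mono (n ∷ ns) (p ∷ ps) le = normal-∈𝒯devⁿ-mono n p le ∷ normal-All∈𝒯devⁿ-mono ns ps le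

mutual
  normal-◁⇒∈𝒯devⁿ : ∀ {s M} → Normal s → s ◁ M → ∃[ k ] (s ∈𝒯 devⁿ k M)
  normal-◁⇒∈𝒯devⁿ n c-var = 0 , 𝒯-var
  normal-◁⇒∈𝒯devⁿ n (c-lam {t} {M} d) with normal-◁⇒∈𝒯devⁿ (Normal-rlam n) d
  ... | k , p = k , subst (rlam t ∈𝒯_) (devⁿ-lam k M) (𝒯-lam p)
  normal-◁⇒∈𝒯devⁿ n (c-mu {b} {t} {M} d) with normal-◁⇒∈𝒯devⁿ (Normal-rmu n) d
  ... | k , p = k , normal-∈𝒯-↠ n (𝒯-mu p) (devⁿ-mu k b M)
  normal-◁⇒∈𝒯devⁿ n (c-app {t} {us} {M} {P} d ds)
    with normal-◁⇒∈𝒯devⁿ (Normal-rappˡ n) d | normal-All◁⇒∈𝒯devⁿ (Normal-rapp-bag n) ds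
  ... | k₀ , p₀ | k , ps = k₀ ⊔ k ,
        normal-∈𝒯-↠ n (𝒯-app (normal-∈𝒯devⁿ-mono (Normal-rappˡ n) p₀ (m≤m⊔n k₀ k))
                             (normal-All∈𝒯devⁿ-mono (Normal-rapp-bag n) ps (m≤n⊔m k₀ k)))
                      (devⁿ-app (k₀ ⊔ k) M P)
  normal-◁⇒∈𝒯devⁿ n (c-red s d) with normal-◁⇒∈𝒯devⁿ n d
  ... | k , p = suc k , normal-∈𝒯-↠ n p (⟶-devⁿ↠devⁿ⁺¹ k s)

  normal-All◁⇒∈𝒯devⁿ : ∀ {us P} → All Normal us → All (_◁ P) us → ∃[ k ] (All (_∈𝒯 devⁿ k P) us)
  normal-All◁⇒∈𝒯devⁿ [] [] = 0 , []
  normal-All◁⇒∈𝒯devⁿ (n ∷ ns) (d ∷ ds) with normal-◁⇒∈𝒯devⁿ n d | normal-All◁⇒∈𝒯devⁿ ns ds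
  ... | k₁ , p | k₂ , ps = k₁ ⊔ k₂ , normal-∈𝒯devⁿ-mono n p (m≤m⊔n k₁ k₂) ∷ normal-All∈𝒯devⁿ-mono ns ps (m≤n⊔m k₁ k₂)

-- Strong normalisation of resource reduction

mutual
  size : RTerm → ℕ
  size (rvar x) = 1
  size (rlam t) = suc (size t)
  size (rmu b t) = suc (size t)
  size (rapp t B) = size t + sizeB B

  sizeB : Bag → ℕ
  sizeB [] = 0
  sizeB (v ∷ B) = size v + sizeB B

headDepth : RTerm → ℕ
headDepth (rvar x) = 1
headDepth (rlam t) = suc (headDepth t)
headDepth (rmu b t) = suc (headDepth t)
headDepth (rapp t B) = headDepth t

-- β- and ρ-steps decrease size; μ-steps preserve size and head depth and decrease
-- potential N 0 for N ≥ size. An application at bag depth d whose head has depth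
-- k weighs (N+1)^((N∸d)(N+1)+k). A μ-step on (μα.t)B removes an application of
-- head depth k+1 and creates at most size t applications, each either at the same
-- bag depth with head depth ≤ k, or deeper in a bag with any head depth ≤ N
-- (weight-deeper-≤). The invariant d + size t ≤ N keeps N ∸ d from truncating.
weight : ℕ → ℕ → ℕ → ℕ
weight N d k = suc N ^ ((N ∸ d) * suc N + k)

mutual
  potential : ℕ → ℕ → RTerm → ℕ
  potential N d (rvar x) = 0
  potential N d (rlam t) = potential N d t
  potential N d (rmu b t) = potential N d t
  potential N d (rapp t B) = weight N d (headDepth t) + potential N d t + potentialB N (suc d) B

  potentialB : ℕ → ℕ → Bag → ℕ
  potentialB N d [] = 0
  potentialB N d (v ∷ B) = potential N d v + potentialB N d B

-- namedCost N d α t bounds the weight of the applications ( )B created by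
-- ⟨t⟩_α B at the occurrences of [α].
mutual
  namedCost : ℕ → ℕ → ℕ → RTerm → ℕ
  namedCost N d α (rvar x) = 0
  namedCost N d α (rlam t) = namedCost N d α t
  namedCost N d α (rmu γ t) = namedCostBody N d (suc α) γ t
  namedCost N d α (rapp t B) = namedCost N d α t + namedCostB N (suc d) α B

  namedCostB : ℕ → ℕ → ℕ → Bag → ℕ
  namedCostB N d α [] = 0
  namedCostB N d α (v ∷ B) = namedCost N d α v + namedCostB N d α B

  namedCostBody : ℕ → ℕ → ℕ → ℕ → RTerm → ℕ
  namedCostBody N d α γ t with γ ≟ α
  ... | yes _ = weight N d (headDepth t) + namedCost N d α t
  ... | no _ = namedCost N d α t

+-mono-≤-interchange : ∀ {a b r} x y p q → a ≤ x + p → b ≤ y + q → p + q ≡ r → a + b ≤ (x + y) + r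
+-mono-≤-interchange x y p q h₁ h₂ e =
  ≤-trans (+-mono-≤ h₁ h₂) (≤-reflexive (trans (interchange x p y q) (cong ((x + y) +_) e)))

+-cong-interchange : ∀ {a b r} x y p q → a ≡ x + p → b ≡ y + q → p + q ≡ r → a + b ≡ (x + y) + r
+-cong-interchange x y p q refl refl e = trans (interchange x p y q) (cong ((x + y) +_) e)

splits2-additive : ∀ (f : Bag → ℕ) → (∀ v B → f (v ∷ B) ≡ f [ v ] + f B) → f [] ≡ 0 → ∀ B →
  All (λ p → f (proj₁ p) + f (proj₂ p) ≡ f B) (splits2 B)
splits2-additive f hc h0 [] = trans (cong (_+ f []) h0) refl ∷ []
splits2-additive f hc h0 (v ∷ B) = concatMap⁺ both-sides (splits2-additive f hc h0 B)
  where
  both-sides : ∀ {p} → f (proj₁ p) + f (proj₂ p) ≡ f B →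
               All (λ p → f (proj₁ p) + f (proj₂ p) ≡ f (v ∷ B))
                   ((v ∷ proj₁ p , proj₂ p) ∷ (proj₁ p , v ∷ proj₂ p) ∷ [])
  both-sides {a , b} e =
    trans (cong (_+ f b) (hc v a)) (trans (+-assoc (f [ v ]) (f a) (f b)) (trans (cong (f [ v ] +_) e) (sym (hc v B)))) ∷
    trans (cong (f a +_) (hc v b)) (trans (x∙yz≈y∙xz (f a) (f [ v ]) (f b)) (trans (cong (f [ v ] +_) e) (sym (hc v B)))) ∷ []

sizeB-splits2 : ∀ B → All (λ p → sizeB (proj₁ p) + sizeB (proj₂ p) ≡ sizeB B) (splits2 B)
sizeB-splits2 = splits2-additive sizeB (λ v B → cong (_+ sizeB B) (sym (+-identityʳ (size v)))) refl

potentialB-splits2 : ∀ N d B → All (λ p → potentialB N d (proj₁ p) + potentialB N d (proj₂ p) ≡ potentialB N d B) (splits2 B)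
potentialB-splits2 N d = splits2-additive (potentialB N d) (λ v B → cong (_+ potentialB N d B) (sym (+-identityʳ (potential N d v)))) refl

mutual
  size-renV : ∀ ρ t → size (renVR ρ t) ≡ size t
  size-renV ρ (rvar x) = refl
  size-renV ρ (rlam t) = cong suc (size-renV (ext ρ) t)
  size-renV ρ (rmu b t) = cong suc (size-renV ρ t)
  size-renV ρ (rapp t B) = cong₂ _+_ (size-renV ρ t) (sizeB-renV ρ B)

  sizeB-renV : ∀ ρ B → sizeB (renVB ρ B) ≡ sizeB B
  sizeB-renV ρ [] = refl
  sizeB-renV ρ (v ∷ B) = cong₂ _+_ (size-renV ρ v) (sizeB-renV ρ B)

mutual
  size-renN : ∀ ρ t → size (renNR ρ t) ≡ size t
  size-renN ρ (rvar x) = refl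
  size-renN ρ (rlam t) = cong suc (size-renN ρ t)
  size-renN ρ (rmu b t) = cong suc (size-renN (ext ρ) t)
  size-renN ρ (rapp t B) = cong₂ _+_ (size-renN ρ t) (sizeB-renN ρ B)

  sizeB-renN : ∀ ρ B → sizeB (renNB ρ B) ≡ sizeB B
  sizeB-renN ρ [] = refl
  sizeB-renN ρ (v ∷ B) = cong₂ _+_ (size-renN ρ v) (sizeB-renN ρ B)

headDepth-renV : ∀ ρ t → headDepth (renVR ρ t) ≡ headDepth t
headDepth-renV ρ (rvar x) = refl
headDepth-renV ρ (rlam t) = cong suc (headDepth-renV (ext ρ) t)
headDepth-renV ρ (rmu b t) = cong suc (headDepth-renV ρ t)
headDepth-renV ρ (rapp t B) = headDepth-renV ρ t

headDepth-renN : ∀ ρ t → headDepth (renNR ρ t) ≡ headDepth t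
headDepth-renN ρ (rvar x) = refl
headDepth-renN ρ (rlam t) = cong suc (headDepth-renN ρ t)
headDepth-renN ρ (rmu b t) = cong suc (headDepth-renN (ext ρ) t)
headDepth-renN ρ (rapp t B) = headDepth-renN ρ t

mutual
  potential-renV : ∀ N d ρ t → potential N d (renVR ρ t) ≡ potential N d t
  potential-renV N d ρ (rvar x) = refl
  potential-renV N d ρ (rlam t) = potential-renV N d (ext ρ) t
  potential-renV N d ρ (rmu b t) = potential-renV N d ρ t
  potential-renV N d ρ (rapp t B) = cong₂ _+_ (cong₂ _+_ (cong (weight N d) (headDepth-renV ρ t)) (potential-renV N d ρ t)) (potentialB-renV N (suc d) ρ B)

  potentialB-renV : ∀ N d ρ B → potentialB N d (renVB ρ B) ≡ potentialB N d B
  potentialB-renV N d ρ [] = refl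
  potentialB-renV N d ρ (v ∷ B) = cong₂ _+_ (potential-renV N d ρ v) (potentialB-renV N d ρ B)

mutual
  potential-renN : ∀ N d ρ t → potential N d (renNR ρ t) ≡ potential N d t
  potential-renN N d ρ (rvar x) = refl
  potential-renN N d ρ (rlam t) = potential-renN N d ρ t
  potential-renN N d ρ (rmu b t) = potential-renN N d (ext ρ) t
  potential-renN N d ρ (rapp t B) = cong₂ _+_ (cong₂ _+_ (cong (weight N d) (headDepth-renN ρ t)) (potential-renN N d ρ t)) (potentialB-renN N (suc d) ρ B)

  potentialB-renN : ∀ N d ρ B → potentialB N d (renNB ρ B) ≡ potentialB N d B
  potentialB-renN N d ρ [] = refl
  potentialB-renN N d ρ (v ∷ B) = cong₂ _+_ (potential-renN N d ρ v) (potentialB-renN N d ρ B)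

onlyEmpty-All-[] : ∀ {A : Set} {R : A → Set} (B : Bag) {x} → (B ≡ [] → R x) → All R (onlyEmpty B x)
onlyEmpty-All-[] [] h = h refl ∷ []
onlyEmpty-All-[] (_ ∷ _) h = []

lsubVar-size : ∀ k B y → All (λ u → size u ≤ 1 + sizeB B) (lsubVar k B y)
lsubVar-size k B y with compare k y
... | less _ m = onlyEmpty-All-[] B (λ { refl → ≤-refl })
... | greater _ _ = onlyEmpty-All-[] B (λ { refl → ≤-refl })
... | equal _ = h B
  where
  h : ∀ B → All (λ u → size u ≤ 1 + sizeB B) (single B)
  h [] = []
  h (v ∷ []) = ≤-trans (m≤m+n (size v) 0) (n≤1+n _) ∷ []
  h (v ∷ _ ∷ _) = []

mutual
  lsub-size : ∀ k B t → All (λ u → size u ≤ size t + sizeB B) (lsub k B t)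
  lsub-size k B (rvar y) = lsubVar-size k B y
  lsub-size k B (rlam t) = gmap⁺ (λ h → s≤s (subst (λ z → _ ≤ size t + z) (sizeB-renV suc B) h))
                           (lsub-size (suc k) (renVB suc B) t)
  lsub-size k B (rmu b t) = gmap⁺ (λ h → s≤s (subst (λ z → _ ≤ size t + z) (sizeB-renN suc B) h))
                           (lsub-size k (renNB suc B) t)
  lsub-size k B (rapp t vs) = concatMap⁺ (λ { {B1 , B2} e → concatMap⁺ (λ h1 → gmap⁺ (λ h2 → +-mono-≤-interchange (size t) (sizeB vs) (sizeB B1) (sizeB B2) h1 h2 e)
      (lsubB-size k B2 vs)) (lsub-size k B1 t) }) (sizeB-splits2 B)

  lsubB-size : ∀ k B vs → All (λ ws → sizeB ws ≤ sizeB vs + sizeB B) (lsubB k B vs)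
  lsubB-size k B [] = onlyEmpty-All-[] B (λ { refl → ≤-refl })
  lsubB-size k B (v ∷ vs) = concatMap⁺ (λ { {B1 , B2} e → concatMap⁺ (λ h1 → gmap⁺ (λ h2 → +-mono-≤-interchange (size v) (sizeB vs) (sizeB B1) (sizeB B2) h1 h2 e)
      (lsubB-size k B2 vs)) (lsub-size k B1 v) }) (sizeB-splits2 B)

weight-mono : ∀ N d {k k'} → k ≤ k' → weight N d k ≤ weight N d k'
weight-mono N d le = ^-monoʳ-≤ (suc N) (+-monoʳ-≤ ((N ∸ d) * suc N) le)

weight-depth-antitone : ∀ N d k → weight N (suc d) k ≤ weight N d k
weight-depth-antitone N d k = ^-monoʳ-≤ (suc N) (+-monoˡ-≤ k (*-monoˡ-≤ (suc N) (∸-monoʳ-≤ N (n≤1+n d))))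

m∸n≡suc[m∸suc[n]] : ∀ N d → d < N → N ∸ d ≡ suc (N ∸ suc d)
m∸n≡suc[m∸suc[n]] (suc N) zero le = refl
m∸n≡suc[m∸suc[n]] (suc N) (suc d) (s≤s le) = m∸n≡suc[m∸suc[n]] N d le

weight-deeper-≤ : ∀ N d k k' → d < N → k' ≤ N → weight N (suc d) k' ≤ weight N d k
weight-deeper-≤ N d k k' dl kl = ^-monoʳ-≤ (suc N) (≤-trans h (≤-reflexive (cong (λ z → z * suc N + k) (sym (m∸n≡suc[m∸suc[n]] N d dl)))))
  where
  x = N ∸ suc d
  h : x * suc N + k' ≤ suc x * suc N + k
  h = ≤-trans (+-monoʳ-≤ (x * suc N) (≤-trans kl (n≤1+n N)))
       (≤-trans (≤-reflexive (+-comm (x * suc N) (suc N))) (m≤m+n (suc N + x * suc N) k))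

weight-suc : ∀ N d k → weight N d (suc k) ≡ suc N * weight N d k
weight-suc N d k = cong (suc N ^_) (+-suc ((N ∸ d) * suc N) k)

weight-pos : ∀ N d k → 1 ≤ weight N d k
weight-pos N d k = m^n>0 (suc N) ((N ∸ d) * suc N + k)

size≥1 : ∀ t → 1 ≤ size t
size≥1 (rvar x) = ≤-refl
size≥1 (rlam t) = s≤s z≤n
size≥1 (rmu b t) = s≤s z≤n
size≥1 (rapp t B) = ≤-trans (size≥1 t) (m≤m+n (size t) (sizeB B))

headDepth≤size : ∀ t → headDepth t ≤ size t
headDepth≤size (rvar x) = ≤-refl
headDepth≤size (rlam t) = s≤s (headDepth≤size t)
headDepth≤size (rmu b t) = s≤s (headDepth≤size t)
headDepth≤size (rapp t B) = ≤-trans (headDepth≤size t) (m≤m+n (size t) (sizeB B))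

mutual
  potential-depth-antitone : ∀ N d t → potential N (suc d) t ≤ potential N d t
  potential-depth-antitone N d (rvar x) = ≤-refl
  potential-depth-antitone N d (rlam t) = potential-depth-antitone N d t
  potential-depth-antitone N d (rmu b t) = potential-depth-antitone N d t
  potential-depth-antitone N d (rapp t B) = +-mono-≤ (+-mono-≤ (weight-depth-antitone N d (headDepth t)) (potential-depth-antitone N d t)) (potentialB-depth-antitone N (suc d) B)

  potentialB-depth-antitone : ∀ N d B → potentialB N (suc d) B ≤ potentialB N d B
  potentialB-depth-antitone N d [] = ≤-refl
  potentialB-depth-antitone N d (v ∷ B) = +-mono-≤ (potential-depth-antitone N d v) (potentialB-depth-antitone N d B)

NapRBound : ℕ → ℕ → ℕ → Bag → RTerm → RTerm → Set
NapRBound N d α B t u = (size u ≡ size t + sizeB B) × (headDepth u ≡ headDepth t)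
  × (potential N d u ≤ potential N d t + potentialB N (suc d) B + namedCost N d α t)

NapBBound : ℕ → ℕ → ℕ → Bag → Bag → Bag → Set
NapBBound N d α B vs ws = (sizeB ws ≡ sizeB vs + sizeB B)
  × (potentialB N d ws ≤ potentialB N d vs + potentialB N (suc d) B + namedCostB N d α vs)

NbodyRBound : ℕ → ℕ → ℕ → ℕ → Bag → RTerm → RTerm → Set
NbodyRBound N d α γ B t u = (size u ≡ size t + sizeB B) × (headDepth u ≡ headDepth t)
  × (potential N d u ≤ potential N d t + potentialB N (suc d) B + namedCostBody N d α γ t)

napR-rapp-potential-≤ : ∀ w Pt PBvs Qt QBvs pb1 pb2 pb2' PBB a b → a ≤ Pt + pb1 + Qt → b ≤ PBvs + pb2' + QBvs → pb2' ≤ pb2 →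
      pb1 + pb2 ≡ PBB → w + a + b ≤ (w + Pt + PBvs) + PBB + (Qt + QBvs)
napR-rapp-potential-≤ w Pt PBvs Qt QBvs pb1 pb2 pb2' PBB a b h1 h2 h3 e =
  ≤-trans (+-mono-≤ (+-monoʳ-≤ w h1) (≤-trans h2 (+-monoˡ-≤ QBvs (+-monoʳ-≤ PBvs h3))))
  (≤-reflexive (trans (regroup w Pt PBvs Qt QBvs pb1 pb2) (cong (λ z → (w + Pt + PBvs) + z + (Qt + QBvs)) e)))
  where
  regroup : ∀ (w Pt PBvs Qt QBvs pb1 pb2 : ℕ) →
        w + (Pt + pb1 + Qt) + (PBvs + pb2 + QBvs) ≡ (w + Pt + PBvs) + (pb1 + pb2) + (Qt + QBvs)
  regroup = solve-∀

napB-∷-potential-≤ : ∀ x y p p' r q1 q2 a b → a ≤ x + p + q1 → b ≤ y + p' + q2 → p + p' ≡ r → a + b ≤ (x + y) + r + (q1 + q2)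
napB-∷-potential-≤ x y p p' r q1 q2 a b h1 h2 e = ≤-trans (+-mono-≤ h1 h2)
  (≤-reflexive (trans (regroup x y p p' q1 q2) (cong (λ z → (x + y) + z + (q1 + q2)) e)))
  where
  regroup : ∀ (x y p p' q1 q2 : ℕ) → (x + p + q1) + (y + p' + q2) ≡ (x + y) + (p + p') + (q1 + q2)
  regroup = solve-∀

nbodyR-bound-potential-≤ : ∀ w Pt pb1 pb2 PBB Qt a → a ≤ Pt + pb1 + Qt → pb1 + pb2 ≡ PBB → w + a + pb2 ≤ Pt + PBB + (w + Qt)
nbodyR-bound-potential-≤ w Pt pb1 pb2 PBB Qt a h e = ≤-trans (+-monoˡ-≤ pb2 (+-monoʳ-≤ w h))
  (≤-reflexive (trans (regroup w Pt pb1 pb2 Qt) (cong (λ z → Pt + z + (w + Qt)) e)))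
  where
  regroup : ∀ (w Pt pb1 pb2 Qt : ℕ) → w + (Pt + pb1 + Qt) + pb2 ≡ Pt + (pb1 + pb2) + (w + Qt)
  regroup = solve-∀

splits2-sizeB-potentialB : ∀ N d B → All (λ p → (sizeB (proj₁ p) + sizeB (proj₂ p) ≡ sizeB B)
                                         × (potentialB N d (proj₁ p) + potentialB N d (proj₂ p) ≡ potentialB N d B)) (splits2 B)
splits2-sizeB-potentialB N d B = curry All.zip (sizeB-splits2 B) (potentialB-splits2 N d B)

mutual
  napR-bound : ∀ N d α B t → All (NapRBound N d α B t) (napR α B t)
  napR-bound N d α B (rvar x) = onlyEmpty-All-[] B (λ { refl → refl , refl , z≤n })
  napR-bound N d α B (rlam t) = gmap⁺ (λ { (e1 , e2 , h) →
      cong suc (trans e1 (cong (size t +_) (sizeB-renV suc B))) , cong suc e2 ,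
      subst (λ z → _ ≤ potential N d t + z + namedCost N d α t) (potentialB-renV N (suc d) suc B) h })
    (napR-bound N d α (renVB suc B) t)
  napR-bound N d α B (rmu γ t) = gmap⁺ (λ { (e1 , e2 , h) →
      cong suc (trans e1 (cong (size t +_) (sizeB-renN suc B))) , cong suc e2 ,
      subst (λ z → _ ≤ potential N d t + z + namedCostBody N d (suc α) γ t) (potentialB-renN N (suc d) suc B) h })
    (nbodyR-bound N d (suc α) γ (renNB suc B) t)
  napR-bound N d α B (rapp t vs) = concatMap⁺ (λ { {B1 , B2} (eC , eP) →
      concatMap⁺ (λ { {u0} (c0 , k0 , h0) → gmap⁺ (λ { {ws} (cw , hw) →
        +-cong-interchange (size t) (sizeB vs) (sizeB B1) (sizeB B2) c0 cw eC , k0 ,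
        subst (λ z → weight N d z + potential N d u0 + potentialB N (suc d) ws ≤ _) (sym k0)
          (napR-rapp-potential-≤ (weight N d (headDepth t)) (potential N d t) (potentialB N (suc d) vs) (namedCost N d α t) (namedCostB N (suc d) α vs)
               (potentialB N (suc d) B1) (potentialB N (suc d) B2) (potentialB N (suc (suc d)) B2) (potentialB N (suc d) B)
               (potential N d u0) (potentialB N (suc d) ws) h0 hw (potentialB-depth-antitone N (suc d) B2) eP) })
        (napB-bound N (suc d) α B2 vs) }) (napR-bound N d α B1 t) }) (splits2-sizeB-potentialB N (suc d) B)

  napB-bound : ∀ N d α B vs → All (NapBBound N d α B vs) (napB α B vs)
  napB-bound N d α B [] = onlyEmpty-All-[] B (λ { refl → refl , z≤n })
  napB-bound N d α B (v ∷ vs) = concatMap⁺ (λ { {B1 , B2} (eC , eP) →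
      concatMap⁺ (λ { {u} (c0 , k0 , h0) → gmap⁺ (λ { {ws} (cw , hw) →
        +-cong-interchange (size v) (sizeB vs) (sizeB B1) (sizeB B2) c0 cw eC ,
        napB-∷-potential-≤ (potential N d v) (potentialB N d vs) (potentialB N (suc d) B1) (potentialB N (suc d) B2) (potentialB N (suc d) B) (namedCost N d α v) (namedCostB N d α vs)
            (potential N d u) (potentialB N d ws) h0 hw eP })
        (napB-bound N d α B2 vs) }) (napR-bound N d α B1 v) }) (splits2-sizeB-potentialB N (suc d) B)

  nbodyR-bound : ∀ N d α γ B t → All (NbodyRBound N d α γ B t) (nbodyR α B γ t)
  nbodyR-bound N d α γ B t with γ ≟ α
  ... | yes _ = concatMap⁺ (λ { {B1 , B2} (eC , eP) → gmap⁺ (λ { {u0} (c0 , k0 , h0) →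
          trans (cong (_+ sizeB B2) c0) (trans (+-assoc (size t) (sizeB B1) (sizeB B2)) (cong (size t +_) eC)) , k0 ,
          subst (λ z → weight N d z + potential N d u0 + potentialB N (suc d) B2 ≤ _) (sym k0)
            (nbodyR-bound-potential-≤ (weight N d (headDepth t)) (potential N d t) (potentialB N (suc d) B1) (potentialB N (suc d) B2) (potentialB N (suc d) B) (namedCost N d α t) (potential N d u0) h0 eP) })
        (napR-bound N d α B1 t) }) (splits2-sizeB-potentialB N (suc d) B)
  ... | no _ = napR-bound N d α B t

+-≤-weakenʳ : ∀ d a b N → d + (a + b) ≤ N → d + a ≤ N
+-≤-weakenʳ d a b N h = ≤-trans (+-monoʳ-≤ d (m≤m+n a b)) h

bag-depth-≤ : ∀ d t b N → d + (size t + b) ≤ N → suc d + b ≤ N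
bag-depth-≤ d t b N h = ≤-trans (≤-reflexive (sym (+-suc d b))) (≤-trans (+-monoʳ-≤ d (+-monoˡ-≤ b (size≥1 t))) h)

mutual
  namedCost-bound : ∀ N d α t → d + size t ≤ N → namedCost N d α t ≤ size t * weight N d (headDepth t)
  namedCost-bound N d α (rvar x) h = z≤n
  namedCost-bound N d α (rlam t) h = ≤-trans (namedCost-bound N d α t (≤-trans (+-monoʳ-≤ d (n≤1+n _)) h))
    (*-mono-≤ (n≤1+n (size t)) (weight-mono N d (n≤1+n (headDepth t))))
  namedCost-bound N d α (rmu γ t) h = ≤-trans (namedCostBody-bound N d (suc α) γ t (≤-trans (+-monoʳ-≤ d (n≤1+n _)) h))
    (*-monoʳ-≤ (suc (size t)) (weight-mono N d (n≤1+n (headDepth t))))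
  namedCost-bound N d α (rapp t vs) h = ≤-trans (+-mono-≤ (namedCost-bound N d α t (+-≤-weakenʳ d (size t) (sizeB vs) N h))
                                                   (namedCostB-bound N d α vs (headDepth t) (bag-depth-≤ d t (sizeB vs) N h)))
    (≤-reflexive (sym (*-distribʳ-+ (weight N d (headDepth t)) (size t) (sizeB vs))))

  namedCostB-bound : ∀ N d α vs k → suc d + sizeB vs ≤ N → namedCostB N (suc d) α vs ≤ sizeB vs * weight N d k
  namedCostB-bound N d α [] k h = z≤n
  namedCostB-bound N d α (v ∷ vs) k h =
    ≤-trans (+-mono-≤ (≤-trans (namedCost-bound N (suc d) α v h1) (*-monoʳ-≤ (size v) (weight-deeper-≤ N d k (headDepth v) dl kl)))
                      (namedCostB-bound N d α vs k h2))
    (≤-reflexive (sym (*-distribʳ-+ (weight N d k) (size v) (sizeB vs))))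
    where
    h1 : suc d + size v ≤ N
    h1 = +-≤-weakenʳ (suc d) (size v) (sizeB vs) N h
    h2 : suc d + sizeB vs ≤ N
    h2 = ≤-trans (+-monoʳ-≤ (suc d) (m≤n+m (sizeB vs) (size v))) h
    dl : d < N
    dl = ≤-trans (m≤m+n (suc d) (size v)) h1
    kl : headDepth v ≤ N
    kl = ≤-trans (headDepth≤size v) (≤-trans (m≤n+m (size v) (suc d)) h1)

  namedCostBody-bound : ∀ N d α γ t → d + size t ≤ N → namedCostBody N d α γ t ≤ suc (size t) * weight N d (headDepth t)
  namedCostBody-bound N d α γ t h with γ ≟ α
  ... | yes _ = +-monoʳ-≤ (weight N d (headDepth t)) (namedCost-bound N d α t h)
  ... | no _ = ≤-trans (namedCost-bound N d α t h) (m≤n+m _ (weight N d (headDepth t)))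

sizeB-++ : ∀ L x R → sizeB (L ++ x ∷ R) ≡ sizeB L + (size x + sizeB R)
sizeB-++ [] x R = refl
sizeB-++ (v ∷ L) x R = trans (cong (size v +_) (sizeB-++ L x R)) (sym (+-assoc (size v) (sizeB L) _))

potentialB-++ : ∀ N d L x R → potentialB N d (L ++ x ∷ R) ≡ potentialB N d L + (potential N d x + potentialB N d R)
potentialB-++ N d [] x R = refl
potentialB-++ N d (v ∷ L) x R = trans (cong (potential N d v +_) (potentialB-++ N d L x R)) (sym (+-assoc (potential N d v) (potentialB N d L) _))

data Decreasing (N d : ℕ) (t u : RTerm) : Set where
  size-< : size u < size t → Decreasing N d t u
  potential-< : size u ≡ size t → headDepth u ≡ headDepth t → potential N d u < potential N d t → Decreasing N d t u

Decreasing-rlam : ∀ {N d t u} → Decreasing N d t u → Decreasing N d (rlam t) (rlam u)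
Decreasing-rlam (size-< lt) = size-< (s≤s lt)
Decreasing-rlam (potential-< e₁ e₂ lt) = potential-< (cong suc e₁) (cong suc e₂) lt

Decreasing-rmu : ∀ {N d b t u} → Decreasing N d t u → Decreasing N d (rmu b t) (rmu b u)
Decreasing-rmu (size-< lt) = size-< (s≤s lt)
Decreasing-rmu (potential-< e₁ e₂ lt) = potential-< (cong suc e₁) (cong suc e₂) lt

Decreasing-rappˡ : ∀ {N d t u} B → Decreasing N d t u → Decreasing N d (rapp t B) (rapp u B)
Decreasing-rappˡ B (size-< lt) = size-< (+-monoˡ-< (sizeB B) lt)
Decreasing-rappˡ {N} {d} {t} {u} B (potential-< e₁ e₂ lt) =
  potential-< (cong (_+ sizeB B) e₁) e₂
    (subst (λ k → weight N d k + potential N d u + potentialB N (suc d) B < weight N d (headDepth t) + potential N d t + potentialB N (suc d) B)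
      (sym e₂) (+-monoˡ-< (potentialB N (suc d) B) (+-monoʳ-< (weight N d (headDepth t)) lt)))

Decreasing-rappʳ : ∀ {N d s t u} L R → Decreasing N (suc d) t u →
                   Decreasing N d (rapp s (L ++ t ∷ R)) (rapp s (L ++ u ∷ R))
Decreasing-rappʳ {s = s} {t} {u} L R (size-< lt) =
  size-< (subst₂ (λ z z′ → size s + z < size s + z′) (sym (sizeB-++ L u R)) (sym (sizeB-++ L t R))
           (+-monoʳ-< (size s) (+-monoʳ-< (sizeB L) (+-monoˡ-< (sizeB R) lt))))
Decreasing-rappʳ {N} {d} {s} {t} {u} L R (potential-< e₁ _ lt) =
  potential-< (cong (size s +_) (trans (sizeB-++ L u R) (trans (cong (λ z → sizeB L + (z + sizeB R)) e₁) (sym (sizeB-++ L t R))))) refl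
    (subst₂ (λ z z′ → weight N d (headDepth s) + potential N d s + z < weight N d (headDepth s) + potential N d s + z′)
      (sym (potentialB-++ N (suc d) L u R)) (sym (potentialB-++ N (suc d) L t R))
      (+-monoʳ-< (weight N d (headDepth s) + potential N d s)
        (+-monoʳ-< (potentialB N (suc d) L) (+-monoˡ-< (potentialB N (suc d) R) lt))))

μ-r-decreasing : ∀ N d {b t B} → d + size (rapp (rmu b t) B) ≤ N →
                 All (Decreasing N d (rapp (rmu b t) B)) (map (rmu b) (nbodyR 0 (renNB suc B) b t))
μ-r-decreasing N d {b} {t} {B} h = gmap⁺ (λ { {u} (e₁ , e₂ , hp) → potential-<
    (cong suc (trans e₁ (cong (size t +_) (sizeB-renN suc B)))) (cong suc e₂)
    (potential-bound (subst (λ z → potential N d u ≤ potential N d t + z + namedCostBody N d 0 b t) (potentialB-renN N (suc d) suc B) hp)) })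
  (nbodyR-bound N d 0 b (renNB suc B) t)
  where
  k = headDepth t
  size-bound : d + size t ≤ N
  size-bound = ≤-trans (+-monoʳ-≤ d (≤-trans (n≤1+n (size t)) (m≤m+n (suc (size t)) (sizeB B)))) h
  size<N : size t < N
  size<N = ≤-trans (m≤n+m (suc (size t)) d) (≤-trans (+-monoʳ-≤ d (m≤m+n (suc (size t)) (sizeB B))) h)
  cost<weight : namedCostBody N d 0 b t < weight N d (suc k)
  cost<weight = begin-strict
    namedCostBody N d 0 b t     ≤⟨ namedCostBody-bound N d 0 b t size-bound ⟩
    suc (size t) * weight N d k <⟨ *-monoˡ-< (weight N d k) {{>-nonZero (weight-pos N d k)}} (s≤s size<N) ⟩
    suc N * weight N d k        ≡⟨ weight-suc N d k ⟨
    weight N d (suc k)          ∎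
    where open ≤-Reasoning
  potential-bound : ∀ {p} → p ≤ potential N d t + potentialB N (suc d) B + namedCostBody N d 0 b t →
                p < weight N d (suc k) + potential N d t + potentialB N (suc d) B
  potential-bound p≤ = ≤-<-trans p≤ (<-≤-trans (+-monoʳ-< (potential N d t + potentialB N (suc d) B) cost<weight)
    (≤-reflexive (trans (+-comm (potential N d t + potentialB N (suc d) B) (weight N d (suc k)))
                        (sym (+-assoc (weight N d (suc k)) (potential N d t) (potentialB N (suc d) B))))))

⟶r-decreasing : ∀ N d {t T} → t ⟶r T → d + size t ≤ N → All (Decreasing N d t) T
⟶r-decreasing N d (β-r {t} {B}) h = All.map (λ le → size-< (s≤s le)) (lsub-size 0 B t)
⟶r-decreasing N d μ-r h = μ-r-decreasing N d h
⟶r-decreasing N d (ρ-r {a} {e} {t}) h = size-< (s≤s (s≤s (≤-reflexive (size-renN (contr a) t)))) ∷ []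
⟶r-decreasing N d (ξ-rlam {t} st) h = gmap⁺ Decreasing-rlam (⟶r-decreasing N d st (≤-trans (+-monoʳ-≤ d (n≤1+n (size t))) h))
⟶r-decreasing N d (ξ-rmu {b} {t} st) h = gmap⁺ Decreasing-rmu (⟶r-decreasing N d st (≤-trans (+-monoʳ-≤ d (n≤1+n (size t))) h))
⟶r-decreasing N d (ξ-rappL {t} {T} {B} st) h = gmap⁺ (Decreasing-rappˡ B) (⟶r-decreasing N d st (+-≤-weakenʳ d (size t) (sizeB B) N h))
⟶r-decreasing N d (ξ-rappR {s} {t} {T} L R st) h = gmap⁺ (Decreasing-rappʳ L R) (⟶r-decreasing N (suc d) st h')
  where
  h' : suc d + size t ≤ N
  h' = bag-depth-≤ d s (size t) N (≤-trans (+-monoʳ-≤ d (+-monoʳ-≤ (size s)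
         (≤-trans (m≤m+n (size t) (sizeB R)) (≤-trans (m≤n+m _ (sizeB L)) (≤-reflexive (sym (sizeB-++ L t R))))))) h)

measure : RTerm → ℕ × ℕ
measure t = size t , potential (size t) 0 t

_≺_ : RTerm → RTerm → Set
_≺_ = ×-Lex _≡_ _<_ _<_ on measure

≺-wellFounded : WellFounded _≺_
≺-wellFounded = On.wellFounded measure (×-wellFounded <-wellFounded <-wellFounded)

↝-decreasing : ∀ {t u} → t ↝ u → u ≺ t
↝-decreasing {t} {u} (_ , st , u∈T) with lookup (⟶r-decreasing (size t) 0 st ≤-refl) u∈T
... | size-< lt = inj₁ lt
... | potential-< e _ lt = inj₂ (e , subst (λ n → potential n 0 u < potential (size t) 0 t) (sym e) lt)

-- Finite branching of resource reduction

Reduction : RTerm → Set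
Reduction t = Σ Sum (t ⟶r_)

ρ-reductions : ∀ a t → List (Reduction (rmu a t))
ρ-reductions a (rvar x) = []
ρ-reductions a (rlam t) = []
ρ-reductions a (rapp t B) = []
ρ-reductions a (rmu e t) = (_ , ρ-r) ∷ []

head-reductions : ∀ t B → List (Reduction (rapp t B))
head-reductions (rvar x) B = []
head-reductions (rlam t) B = (_ , β-r) ∷ []
head-reductions (rapp t B') B = []
head-reductions (rmu b t) B = (_ , μ-r) ∷ []

cast-reductions : ∀ {s B B'} → B ≡ B' → List (Reduction (rapp s B)) → List (Reduction (rapp s B'))
cast-reductions refl xs = xs

-- bag-reductions s L B lists the reductions of rapp s (L ++ B) inside B.
mutual
  reductions : (t : RTerm) → List (Reduction t)
  reductions (rvar x) = []
  reductions (rlam t) = map (λ p → map rlam (proj₁ p) , ξ-rlam (proj₂ p)) (reductions t)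
  reductions (rmu a t) = ρ-reductions a t ++ map (λ p → map (rmu a) (proj₁ p) , ξ-rmu (proj₂ p)) (reductions t)
  reductions (rapp t B) = head-reductions t B
    ++ (map (λ p → map (λ u → rapp u B) (proj₁ p) , ξ-rappL (proj₂ p)) (reductions t) ++ bag-reductions t [] B)

  bag-reductions : ∀ s L B → List (Reduction (rapp s (L ++ B)))
  bag-reductions s L [] = []
  bag-reductions s L (v ∷ R) = map (λ p → _ , ξ-rappR L R (proj₂ p)) (reductions v)
    ++ cast-reductions (++-assoc L [ v ] R) (bag-reductions s (L ++ [ v ]) R)

Listed : ∀ t → Sum → Set
Listed t T = Any (λ p → proj₁ p ≡ T) (reductions t)

Any-cast-reductions : ∀ {s B B'} (eq : B ≡ B') {X} (xs : List (Reduction (rapp s B))) →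
                      Any (λ p → proj₁ p ≡ X) xs → Any (λ p → proj₁ p ≡ X) (cast-reductions eq xs)
Any-cast-reductions refl xs a = a

mutual
  reductions-complete : ∀ {t T} → (st : t ⟶r T) → Listed t T
  reductions-complete β-r = here refl
  reductions-complete μ-r = here refl
  reductions-complete ρ-r = here refl
  reductions-complete (ξ-rlam st) = Any.gmap (cong (map rlam)) (reductions-complete st)
  reductions-complete (ξ-rmu {b} {t} st) = ++⁺ʳ (ρ-reductions b t) (Any.gmap (cong (map (rmu b))) (reductions-complete st))
  reductions-complete (ξ-rappL {t} {T} {B} st) =
    ++⁺ʳ (head-reductions t B) (++⁺ˡ (Any.gmap (cong (map (λ u → rapp u B))) (reductions-complete st)))
  reductions-complete (ξ-rappR {s} {t} {T} L R st) = ++⁺ʳ (head-reductions s (L ++ t ∷ R))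
    (++⁺ʳ (map (λ p → map (λ u → rapp u (L ++ t ∷ R)) (proj₁ p) , ξ-rappL (proj₂ p)) (reductions s)) (bag-reductions-complete s [] L R st))

  bag-reductions-complete : ∀ s L0 L {t T} R → (st : t ⟶r T) →
    Any (λ p → proj₁ p ≡ map (λ u → rapp s (L0 ++ L ++ u ∷ R)) T) (bag-reductions s L0 (L ++ t ∷ R))
  bag-reductions-complete s L0 [] R st = ++⁺ˡ (Any.gmap (cong (map (λ u → rapp s (L0 ++ u ∷ R)))) (reductions-complete st))
  bag-reductions-complete s L0 (v ∷ L) {t} {T} R st = ++⁺ʳ (map (λ p → _ , ξ-rappR L0 (L ++ t ∷ R) (proj₂ p)) (reductions v))
    (Any-cast-reductions (++-assoc L0 [ v ] (L ++ t ∷ R)) (bag-reductions s (L0 ++ [ v ]) (L ++ t ∷ R))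
      (Any.map (λ e → trans e (map-cong (λ u → cong (rapp s) (++-assoc L0 [ v ] (L ++ u ∷ R))) T))
        (bag-reductions-complete s (L0 ++ [ v ]) L R st)))

reducts : RTerm → List RTerm
reducts t = concatMap proj₁ (reductions t)

reducts-complete : ∀ {t u} → t ↝ u → u ∈ reducts t
reducts-complete {t} (_ , st , u∈T) = go (reductions t) (reductions-complete st)
  where
  go : ∀ (xs : List (Reduction t)) → Any (λ p → proj₁ p ≡ _) xs → _ ∈ concatMap proj₁ xs
  go (p ∷ xs) (here refl) = ∈-++⁺ˡ u∈T
  go (p ∷ xs) (there a) = ∈-++⁺ʳ (proj₁ p) (go xs a)

reducts-sound : ∀ {t u} → u ∈ reducts t → t ↝ u
reducts-sound {t} = go (reductions t)
  where
  go : ∀ {u} (xs : List (Reduction t)) → u ∈ concatMap proj₁ xs → t ↝ u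
  go ((T , st) ∷ xs) u∈ with ∈-++⁻ T u∈
  ... | inj₁ u∈T = T , st , u∈T
  ... | inj₂ u∈xs = go xs u∈xs

normal? : ∀ t → Dec (Normal t)
normal? t with reductions t in eq
... | [] = yes λ T st → ¬Any[] (subst (Any _) eq (reductions-complete st))
... | (_ , st) ∷ _ = no λ n → n _ st

-- Normal descendants

descendant-of-source : ∀ {T S s} → Star _⟶s_ T S → s ∈ S → ∃[ t ] (t ∈ T × Star _↝_ t s)
descendant-of-source {s = s} ε s∈S = s , s∈S , ε
descendant-of-source (step {t} {U} L R st ◅ T′↠S) s∈S with descendant-of-source T′↠S s∈S
... | t′ , t′∈T′ , t′↝s with ∈-++⁻ L t′∈T′
...   | inj₁ t′∈L = t′ , ∈-++⁺ˡ t′∈L , t′↝s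
...   | inj₂ t′∈UR with ∈-++⁻ U t′∈UR
...     | inj₁ t′∈U = t , ∈-++⁺ʳ L (here refl) , (U , st , t′∈U) ◅ t′↝s
...     | inj₂ t′∈R = t′ , ∈-++⁺ʳ L (there t′∈R) , t′↝s

NormalS⇒Normal : ∀ {s S} → NormalS S → s ∈ S → Normal s
NormalS⇒Normal normal s∈S T st with ∈-∃++ s∈S
... | L , R , refl = normal _ (step L R st)

Bounded : Term → ℕ → RTerm → Set
Bounded M K t = ∀ {s} → Star _↝_ t s → Normal s → s ∈𝒯 devⁿ K M

Bounded-mono : ∀ {M K K′ t} → K ≤ K′ → Bounded M K t → Bounded M K′ t
Bounded-mono K≤K′ b t↝s n = normal-∈𝒯devⁿ-mono n (b t↝s n) K≤K′

Bounded-max : ∀ {M T} → All (λ t → ∃[ K ] Bounded M K t) T → ∃[ K ] All (Bounded M K) T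
Bounded-max [] = 0 , []
Bounded-max ((K₁ , b) ∷ bs) with Bounded-max bs
... | K₂ , bs′ = K₁ ⊔ K₂ , Bounded-mono (m≤m⊔n K₁ K₂) b ∷ All.map (Bounded-mono (m≤n⊔m K₁ K₂)) bs′

Bounded-normal : ∀ {M K t} → Normal t → t ∈𝒯 devⁿ K M → Bounded M K t
Bounded-normal n t∈𝒯 ε _ = t∈𝒯
Bounded-normal n t∈𝒯 ((_ , st , _) ◅ _) _ = ⊥-elim (n _ st)

Bounded-↝ : ∀ {M K t} → ¬ Normal t → (∀ {u} → t ↝ u → Bounded M K u) → Bounded M K t
Bounded-↝ ¬n b ε n = ⊥-elim (¬n n)
Bounded-↝ ¬n b (t↝u ◅ u↝s) n = b t↝u u↝s n

◁⇒Bounded : ∀ {M} t → t ◁ M → ∃[ K ] Bounded M K t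
◁⇒Bounded {M} = All.wfRec ≺-wellFounded _ (λ t → t ◁ M → ∃[ K ] Bounded M K t) bound-by-reducts
  where
  bound-by-reducts : ∀ t → (∀ {u} → u ≺ t → u ◁ M → ∃[ K ] Bounded M K u) → t ◁ M → ∃[ K ] Bounded M K t
  bound-by-reducts t rec t◁M with normal? t
  ... | yes n = let k , t∈𝒯 = normal-◁⇒∈𝒯devⁿ n t◁M in k , Bounded-normal {M} {k} n t∈𝒯
  ... | no ¬n = K , Bounded-↝ {M} {K} ¬n (λ t↝u → lookup bounds (reducts-complete t↝u))
    where
    bounds-reducts : ∃[ K ] All (Bounded M K) (reducts t)
    bounds-reducts = Bounded-max (All.tabulate λ u∈ →
      let t↝u = reducts-sound u∈ in rec (↝-decreasing t↝u) (◁-↝ t◁M t↝u))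
    K = proj₁ bounds-reducts
    bounds = proj₂ bounds-reducts

corollary3p8 : (M : Term) (T : Sum) → T ⊆𝒯 M →
    ∃[ N ] (M ↠ N × (∀ S → IsNF T S → S ⊆𝒯 N))
corollary3p8 M T T⊆𝒯M with Bounded-max (All.map (λ t∈𝒯 → ◁⇒Bounded _ (∈𝒯⇒◁ t∈𝒯)) T⊆𝒯M)
... | K , bounds = devⁿ K M , ↠devⁿ K M , λ S (T↠S , normal) → All.tabulate λ s∈S →
  let t , t∈T , t↝s = descendant-of-source T↠S s∈S in lookup bounds t∈T t↝s (NormalS⇒Normal normal s∈S)
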